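{- Let $\kappa\in(0,1)$ and $\eta\in(0,\frac12)$. For all sufficiently large $n$ (with $n^{1/3}$ an integer), the following holds: for every $\kappa$-template-graph $G_\kappa$ on $[n]$, every orientation $\vec G_\kappa$ of it, and every $\eta$-weak tiling $W_1,\dots,W_m,R$ of $\vec G_\kappa$, the free matrix $M$ of this tiling has an $\eta$-good sub-matrix $M[\mathcal W,U]$ with $|U|=2n^{2/3}$ columns.
   Context: A $\kappa$-template-graph is an undirected graph $G$ on $[n]$ such that for every pair of disjoint $H_1,H_2\subseteq[n]$ of size at least $\kappa n^{2/3}$ there is an edge of $G$ between them. For $X\subseteq[n]$, $d^+(X)$ is the number of arcs of $\vec G_\kappa$ from $X$ to $[n]\setminus X$; $X$ is $\eta$-weak if $d^+(X)<(1/2+\eta)n$. An $\eta$-weak tiling is a partition $W_1,\dots,W_m,R$ of $[n]$ with $|W_i|=n^{2/3}$, $|R|<2n^{2/3}$, every $W_i$ $\eta$-weak; $\mathcal W=\{W_1,\dots,W_m\}$. For $W\subseteq[n]$, $N^+(W)$ is the union of out-neighbourhoods in $\vec G_\kappa$ of vertices of $W$, and the free set is $F(W)=[n]\setminus(N^+(W)\cup W)$. The free matrix $M$ is the $0/1$ matrix with rows indexed by $\mathcal W$ and columns by $[n]$, with entry $1$ at $(W_i,v)$ iff $v\in F(W_i)$. For $\mathcal W'\subseteq\mathcal W$, $U\subseteq[n]$, $M[\mathcal W',U]$ is the induced sub-matrix; its weight is its number of $1$'s. A sub-matrix $M[\mathcal W,U]$ is $\eta$-good if each of its rows has weight at least $(\frac12-\eta-2n^{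 -1/3}(\log n)^{1/2})|U|$ ($\log$ natural).
   Formalization: The parameters κ and η range over the rationals. -}

module Defs where

open import Data.Bool using (Bool; true; false; if_then_else_; _∧_; not)
open import Data.Nat as ℕ using (ℕ; zero; suc; _^_)
open import Data.Fin using (Fin; zero; suc)
open import Data.Fin.Subset using (Subset; _∈_; _∉_; ∣_∣; inside; outside)
open import Data.Vec using (lookup)
open import Data.Integer using (+_)
open import Data.Rational using (ℚ; _/_; _+_; _*_; _-_; _<_; _≤_; ½; 0ℚ; 1ℚ)
open import Data.Product using (Σ; ∃; ∃-syntax; _×_; _,_)
open import Data.Sum using (_⊎_)
open import Data.Unit using (⊤)
open import Relation.Binary.PropositionalEquality using (_≡_; _≢_)
open import Relation.Nullary using (¬_)

ℕ→ℚ : ℕ → ℚ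
ℕ→ℚ n = + n / 1

sumFin : ∀ {n} → (Fin n → ℕ) → ℕ
sumFin {zero}  f = 0
sumFin {suc n} f = f zero ℕ.+ sumFin (λ i → f (suc i))

countFin : ∀ {n} → (Fin n → Bool) → ℕ
countFin f = sumFin (λ i → if f i then 1 else 0)

mem : ∀ {n} → Subset n → Fin n → Bool
mem X v = lookup X v

record Graph (n : ℕ) : Set where
  field
    adj   : Fin n → Fin n → Bool
    loopless : ∀ v → adj v v ≡ false
    sym   : ∀ u v → adj u v ≡ adj v u
open Graph public

IsOrientation : ∀ {n} → Graph n → (Fin n → Fin n → Bool) → Set
IsOrientation G D =
  (∀ u v → D u v ≡ true → adj G u v ≡ true) ×
  (∀ u v → adj G u v ≡ true → (D u v ≡ true × D v u ≡ false) ⊎ (D u v ≡ false × D v u ≡ true))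

Disjoint : ∀ {n} → Subset n → Subset n → Set
Disjoint H₁ H₂ = ∀ v → v ∈ H₁ → v ∉ H₂

-- κ-template-graph, where n = t^3 so that n^{2/3} = t^2
IsTemplate : (κ : ℚ) (t : ℕ) → Graph (t ^ 3) → Set
IsTemplate κ t G =
  ∀ (H₁ H₂ : Subset (t ^ 3)) → Disjoint H₁ H₂ →
    κ * ℕ→ℚ (t ^ 2) ≤ ℕ→ℚ ∣ H₁ ∣ → κ * ℕ→ℚ (t ^ 2) ≤ ℕ→ℚ ∣ H₂ ∣ →
    ∃[ u ] ∃[ v ] (u ∈ H₁ × v ∈ H₂ × adj G u v ≡ true)

outDeg : ∀ {n} → (Fin n → Fin n → Bool) → Subset n → ℕ
outDeg D X = sumFin (λ u → countFin (λ v → mem X u ∧ not (mem X v) ∧ D u v))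

IsWeak : ∀ {n} → ℚ → (Fin n → Fin n → Bool) → Subset n → Set
IsWeak {n} η D X = ℕ→ℚ (outDeg D X) < (½ + η) * ℕ→ℚ n

record WeakTiling (η : ℚ) (t : ℕ) (D : Fin (t ^ 3) → Fin (t ^ 3) → Bool) : Set where
  field
    m     : ℕ
    W     : Fin m → Subset (t ^ 3)
    R     : Subset (t ^ 3)
    W-disj  : ∀ i j v → v ∈ W i → v ∈ W j → i ≡ j
    WR-disj : ∀ i v → v ∈ W i → v ∉ R
    cover   : ∀ v → v ∈ R ⊎ ∃[ i ] v ∈ W i
    W-size  : ∀ i → ∣ W i ∣ ≡ t ^ 2
    R-size  : ∣ R ∣ ℕ.< 2 ℕ.* t ^ 2
    W-weak  : ∀ i → IsWeak η D (W i)
open WeakTiling public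

isFree : ∀ {n} → (Fin n → Fin n → Bool) → Subset n → Fin n → Bool
isFree D X v = not (mem X v) ∧ not (anyIn X v)
  where
  anyIn : Subset _ → Fin _ → Bool
  anyIn X v = if countFin (λ u → mem X u ∧ D u v) ℕ.≡ᵇ 0 then false else true

-- weight of row i of the free matrix restricted to columns U
rowWeight : ∀ {t D η} → (T : WeakTiling η t D) → Fin (m T) → Subset (t ^ 3) → ℕ
rowWeight {D = D} T i U = countFin (λ v → mem U v ∧ isFree D (W T i) v)

-- Natural logarithm / square root comparisons, via the exponential series.
-- expPartial y k = Σ_{j=0}^{k} y^j / j!.  For y ≥ 0 these partial sums
-- increase to exp y, hence  y ≤ ln n  ⇔  exp y ≤ n  ⇔  ∀ k, expPartial y k ≤ n.

expTerm : ℚ → ℕ → ℚ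
expTerm y zero    = 1ℚ
expTerm y (suc j) = expTerm y j * y * (+ 1 / suc j)

expPartial : ℚ → ℕ → ℚ
expPartial y zero    = 1ℚ
expPartial y (suc k) = expPartial y k + expTerm y (suc k)

-- y ≤ ln n   (for y ≥ 0)
LeLn : ℚ → ℕ → Set
LeLn y n = ∀ k → expPartial y k ≤ ℕ→ℚ n

-- x ≤ (ln n)^{1/2}   (for n ≥ 1)
LeSqrtLn : ℚ → ℕ → Set
LeSqrtLn x n = x ≤ 0ℚ ⊎ (0ℚ ≤ x × LeLn (x * x) n)

-- η-goodness of a row of weight w over s = |U| > 0 columns, with n = t^3, n^{-1/3} = 1/t:
--   w ≥ (1/2 − η − 2 t⁻¹ (ln n)^{1/2}) s
-- ⇔ ((1/2 − η) s − w) · t / (2 s) ≤ (ln n)^{1/2}.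
-- (for s = 0 the condition reads w ≥ 0, which always holds)
GoodRow : (η : ℚ) (t s w : ℕ) → Set
GoodRow η t zero    w = ⊤
GoodRow η t (suc s) w =
  LeSqrtLn (((½ - η) * ℕ→ℚ (suc s) - ℕ→ℚ w) * ℕ→ℚ t * (+ 1 / (2 ℕ.* suc s))) (t ^ 3)

{-# OPTIONS --safe #-}
-- The free set of a weak tile W misses at most |W| + d⁺(W) < (½ + η) n + n^{2/3} vertices,
-- so every row of the free matrix has density about ½ - η. Cut the first s q vertices,
-- s = 2 n^{2/3} and q = ⌊n^{1/3}/2⌋, into s blocks of q consecutive vertices and pick one
-- vertex per block: a uniform pick meets every row about (½ - η) s times, with Chernoff
-- concentration, and a union bound over the at most n^{1/3} rows leaves room for a deficit
-- of order n^{1/3} √(log n). The method of conditional expectations, applied to the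
-- pessimistic estimator Σᵢ Πᵦ (weight of the pick in block b for row i), with weight N for
-- a hit and N + 1 for a miss, finds such a pick deterministically. All exponential
-- estimates are replaced by Bernoulli-type inequalities in ℕ, and the comparison with
-- (ln n)^{1/2} goes through partial sums of the exponential series.

module Submission where

module FiniteSums where

  open import Data.Bool using (Bool; true; false; if_then_else_)
  open import Data.Nat
  open import Data.Nat.Properties
  open import Data.Fin using (Fin; zero; suc; toℕ)
  open import Relation.Binary.PropositionalEquality
  open import Defs using (sumFin; countFin)
  open import Algebra.Properties.CommutativeSemigroup +-commutativeSemigroup
    using () renaming (interchange to +-interchange)

  sum< : ℕ → (ℕ → ℕ) → ℕ
  sum< zero    f = 0
  sum< (suc n) f = f 0 + sum< n (λ i → f (suc i))

  prod< : ℕ → (ℕ → ℕ) → ℕ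
  prod< zero    f = 1
  prod< (suc n) f = f 0 * prod< n (λ i → f (suc i))

  indicator : Bool → ℕ
  indicator b = if b then 1 else 0

  indicator≤1 : ∀ b → indicator b ≤ 1
  indicator≤1 true  = ≤-refl
  indicator≤1 false = z≤n

  sum<-cong : ∀ n {f g : ℕ → ℕ} → (∀ i → i < n → f i ≡ g i) → sum< n f ≡ sum< n g
  sum<-cong zero    eq = refl
  sum<-cong (suc n) eq = cong₂ _+_ (eq 0 z<s) (sum<-cong n (λ i i<n → eq (suc i) (s<s i<n)))

  sum<-mono-≤ : ∀ n {f g : ℕ → ℕ} → (∀ i → i < n → f i ≤ g i) → sum< n f ≤ sum< n g
  sum<-mono-≤ zero    le = z≤n
  sum<-mono-≤ (suc n) le = +-mono-≤ (le 0 z<s) (sum<-mono-≤ n (λ i i<n → le (suc i) (s<s i<n)))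

  sum<-const : ∀ n c → sum< n (λ _ → c) ≡ n * c
  sum<-const zero    c = refl
  sum<-const (suc n) c = cong (c +_) (sum<-const n c)

  sum<-zero : ∀ n {f : ℕ → ℕ} → (∀ i → i < n → f i ≡ 0) → sum< n f ≡ 0
  sum<-zero n eq = trans (sum<-cong n eq) (trans (sum<-const n 0) (*-zeroʳ n))

  sum<-indicator≤ : ∀ n (f : ℕ → Bool) → sum< n (λ i → indicator (f i)) ≤ n
  sum<-indicator≤ n f = begin
    sum< n (λ i → indicator (f i)) ≤⟨ sum<-mono-≤ n (λ i _ → indicator≤1 (f i)) ⟩
    sum< n (λ _ → 1)               ≡⟨ sum<-const n 1 ⟩
    n * 1                          ≡⟨ *-identityʳ n ⟩
    n                              ∎
    where open ≤-Reasoning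

  sum<-distrib-+ : ∀ n (f g : ℕ → ℕ) → sum< n (λ i → f i + g i) ≡ sum< n f + sum< n g
  sum<-distrib-+ zero    f g = refl
  sum<-distrib-+ (suc n) f g = begin
    f 0 + g 0 + sum< n (λ i → f (suc i) + g (suc i))             ≡⟨ cong (f 0 + g 0 +_) (sum<-distrib-+ n _ _) ⟩
    f 0 + g 0 + (sum< n (λ i → f (suc i)) + sum< n (λ i → g (suc i))) ≡⟨ +-interchange (f 0) (g 0) _ _ ⟩
    f 0 + sum< n (λ i → f (suc i)) + (g 0 + sum< n (λ i → g (suc i))) ∎
    where open ≡-Reasoning

  sum<-*ˡ : ∀ n c (f : ℕ → ℕ) → sum< n (λ i → c * f i) ≡ c * sum< n f
  sum<-*ˡ zero    c f = sym (*-zeroʳ c)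
  sum<-*ˡ (suc n) c f = trans (cong (c * f 0 +_) (sum<-*ˡ n c _)) (sym (*-distribˡ-+ c (f 0) _))

  sum<-splitAt : ∀ a b (f : ℕ → ℕ) → sum< (a + b) f ≡ sum< a f + sum< b (λ i → f (a + i))
  sum<-splitAt zero    b f = refl
  sum<-splitAt (suc a) b f = trans (cong (f 0 +_) (sum<-splitAt a b _)) (sym (+-assoc (f 0) _ _))

  sum<-blocks : ∀ s q (f : ℕ → ℕ) → sum< (s * q) f ≡ sum< s (λ b → sum< q (λ j → f (b * q + j)))
  sum<-blocks zero    q f = refl
  sum<-blocks (suc s) q f = begin
    sum< (q + s * q) f                                                ≡⟨ sum<-splitAt q (s * q) f ⟩
    sum< q f + sum< (s * q) (λ i → f (q + i))                          ≡⟨ cong (sum< q f +_) (sum<-blocks s q _) ⟩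
    sum< q f + sum< s (λ b → sum< q (λ j → f (q + (b * q + j))))       ≡⟨ cong (sum< q f +_) (sum<-cong s (λ b _ →
                                                                           sum<-cong q (λ j _ → cong f (sym (+-assoc q (b * q) j))))) ⟩
    sum< q f + sum< s (λ b → sum< q (λ j → f (suc b * q + j)))         ∎
    where open ≡-Reasoning

  sumFin-cong : ∀ {n} {f g : Fin n → ℕ} → (∀ i → f i ≡ g i) → sumFin f ≡ sumFin g
  sumFin-cong {zero}  eq = refl
  sumFin-cong {suc n} eq = cong₂ _+_ (eq zero) (sumFin-cong (λ i → eq (suc i)))

  sumFin-mono-≤ : ∀ {n} {f g : Fin n → ℕ} → (∀ i → f i ≤ g i) → sumFin f ≤ sumFin g
  sumFin-mono-≤ {zero}  le = z≤n
  sumFin-mono-≤ {suc n} le = +-mono-≤ (le zero) (sumFin-mono-≤ (λ i → le (suc i)))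

  sumFin-const : ∀ n c → sumFin {n} (λ _ → c) ≡ n * c
  sumFin-const zero    c = refl
  sumFin-const (suc n) c = cong (c +_) (sumFin-const n c)

  sumFin-distrib-+ : ∀ {n} (f g : Fin n → ℕ) → sumFin (λ i → f i + g i) ≡ sumFin f + sumFin g
  sumFin-distrib-+ {zero}  f g = refl
  sumFin-distrib-+ {suc n} f g = trans (cong (f zero + g zero +_) (sumFin-distrib-+ (λ i → f (suc i)) (λ i → g (suc i))))
                                       (+-interchange (f zero) (g zero) _ _)

  sumFin-*ˡ : ∀ {n} c (f : Fin n → ℕ) → sumFin (λ i → c * f i) ≡ c * sumFin f
  sumFin-*ˡ {zero}  c f = sym (*-zeroʳ c)
  sumFin-*ˡ {suc n} c f = trans (cong (c * f zero +_) (sumFin-*ˡ c (λ i → f (suc i)))) (sym (*-distribˡ-+ c (f zero) _))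

  sumFin-comm : ∀ {m n} (f : Fin m → Fin n → ℕ) →
    sumFin (λ i → sumFin (λ j → f i j)) ≡ sumFin (λ j → sumFin (λ i → f i j))
  sumFin-comm {zero}  {n} f = sym (trans (sumFin-const n 0) (*-zeroʳ n))
  sumFin-comm {suc m} {n} f = trans (cong (sumFin (f zero) +_) (sumFin-comm (λ i → f (suc i))))
                                    (sym (sumFin-distrib-+ (f zero) _))

  sum<-sumFin-comm : ∀ {m} n (f : Fin m → ℕ → ℕ) →
    sum< n (λ j → sumFin (λ i → f i j)) ≡ sumFin (λ i → sum< n (f i))
  sum<-sumFin-comm {m} zero    f = sym (trans (sumFin-const m 0) (*-zeroʳ m))
  sum<-sumFin-comm     (suc n) f = trans (cong (sumFin (λ i → f i 0) +_) (sum<-sumFin-comm n (λ i j → f i (suc j))))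
                                         (sym (sumFin-distrib-+ (λ i → f i 0) _))

  f≤sumFin : ∀ {n} (f : Fin n → ℕ) i → f i ≤ sumFin f
  f≤sumFin f zero    = m≤m+n _ _
  f≤sumFin f (suc i) = ≤-trans (f≤sumFin (λ j → f (suc j)) i) (m≤n+m _ _)

  sumFin-≤-* : ∀ {n} {f : Fin n → ℕ} {C} → (∀ i → f i ≤ C) → sumFin f ≤ n * C
  sumFin-≤-* {n} {C = C} le = ≤-trans (sumFin-mono-≤ le) (≤-reflexive (sumFin-const n C))

  sumFin-<-* : ∀ {n} {f : Fin n → ℕ} {C} → (∀ i → f i < C) → Fin n → sumFin f < n * C
  sumFin-<-* {suc n} lt _ = +-mono-<-≤ (lt zero) (sumFin-≤-* (λ i → <⇒≤ (lt (suc i))))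

  sumFin<-by-terms : ∀ {m} (f : Fin m → ℕ) {C} → (∀ i → m * f i < C) → Fin m → sumFin f < C
  sumFin<-by-terms {m} f {C} lt i = *-cancelˡ-< m _ _ (begin-strict
    m * sumFin f           ≡⟨ sumFin-*ˡ m f ⟨
    sumFin (λ j → m * f j) <⟨ sumFin-<-* lt i ⟩
    m * C                  ∎)
    where open ≤-Reasoning

  liftℕ : ∀ {n} → (Fin n → Bool) → ℕ → Bool
  liftℕ {zero}  f k       = false
  liftℕ {suc n} f zero    = f zero
  liftℕ {suc n} f (suc k) = liftℕ (λ v → f (suc v)) k

  liftℕ-toℕ : ∀ {n} (f : Fin n → Bool) v → liftℕ f (toℕ v) ≡ f v
  liftℕ-toℕ f zero    = refl
  liftℕ-toℕ f (suc v) = liftℕ-toℕ (λ w → f (suc w)) v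

  countFin-toℕ : ∀ {n} (g : ℕ → Bool) → countFin {n} (λ v → g (toℕ v)) ≡ sum< n (λ k → indicator (g k))
  countFin-toℕ {zero}  g = refl
  countFin-toℕ {suc n} g = cong (indicator (g 0) +_) (countFin-toℕ {n} (λ k → g (suc k)))

  countFin-liftℕ : ∀ {n} (f : Fin n → Bool) → countFin f ≡ sum< n (λ k → indicator (liftℕ f k))
  countFin-liftℕ {zero}  f = refl
  countFin-liftℕ {suc n} f = cong (indicator (f zero) +_) (countFin-liftℕ (λ v → f (suc v)))


module ConditionalExpectation where

  open import Data.Bool using (Bool; true; false)
  open import Data.Nat
  open import Data.Nat.Properties
  open import Data.Fin using (Fin)
  open import Data.Product using (Σ-syntax; ∃-syntax; _×_; _,_)
  open import Relation.Binary.PropositionalEquality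
  open import Function using (_⟨_⟩_)
  open import Relation.Nullary using (yes; no)
  open import Data.Nat.Tactic.RingSolver using (solve-∀)
  open import Defs using (sumFin)
  open FiniteSums

  below-average : ∀ q (f : ℕ → ℕ) → 0 < q → ∃[ v ] (v < q × q * f v ≤ sum< q f)
  below-average (suc zero)    f _ = 0 , z<s , ≤-refl
  below-average (suc (suc q)) f _ with below-average (suc q) (λ i → f (suc i)) z<s
  ... | v , v<q , le with f 0 ≤? f (suc v)
  ...   | yes f0≤ = 0 , z<s , +-monoʳ-≤ (f 0) (≤-trans (*-monoʳ-≤ (suc q) f0≤) le)
  ...   | no  f0≰ = suc v , s<s v<q , +-mono-≤ (<⇒≤ (≰⇒> f0≰)) le

  private
    conditional-on-first : ∀ {m} q s (g : Fin m → ℕ → ℕ → ℕ) (α : Fin m → ℕ) → ℕ → ℕ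
    conditional-on-first q s g α v = sumFin (λ i → α i * g i 0 v * prod< s (λ b → sum< q (g i (suc b))))

  -- Method of conditional expectations: the right-hand side is q ^ s times the average
  -- of the left-hand sum over all choices c.
  choice-below-average : ∀ {m} q s (g : Fin m → ℕ → ℕ → ℕ) (α : Fin m → ℕ) → 0 < q →
    Σ[ c ∈ (ℕ → ℕ) ] ((∀ b → b < s → c b < q) ×
            q ^ s * sumFin (λ i → α i * prod< s (λ b → g i b (c b)))
              ≤ sumFin (λ i → α i * prod< s (λ b → sum< q (g i b))))
  choice-below-average q zero    g α _   = (λ _ → 0) , (λ _ ()) , ≤-reflexive (+-identityʳ _)
  choice-below-average q (suc s) g α q>0
    with v₀ , v₀<q , v₀-below ← below-average q (conditional-on-first q s g α) q>0
    with c′ , c′<q , c′-below ← choice-below-average q s (λ i b → g i (suc b)) (λ i → α i * g i 0 v₀) q>0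
    = c , c<q , bound
    where
    c : ℕ → ℕ
    c zero    = v₀
    c (suc b) = c′ b
    c<q : ∀ b → b < suc s → c b < q
    c<q zero    _         = v₀<q
    c<q (suc b) (s<s b<s) = c′<q b b<s
    rest : _ → ℕ
    rest i = prod< s (λ b → sum< q (g i (suc b)))
    sum-first : ∀ i → sum< q (λ v → α i * g i 0 v * rest i) ≡ α i * (sum< q (g i 0) * rest i)
    sum-first i = begin
      sum< q (λ v → α i * g i 0 v * rest i)   ≡⟨ sum<-cong q (λ v _ → swap (α i) (g i 0 v) (rest i)) ⟩
      sum< q (λ v → α i * rest i * g i 0 v)   ≡⟨ sum<-*ˡ q (α i * rest i) (g i 0) ⟩
      α i * rest i * sum< q (g i 0)           ≡⟨ swap′ (α i) (rest i) (sum< q (g i 0)) ⟩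
      α i * (sum< q (g i 0) * rest i)         ∎
      where
      open ≡-Reasoning
      swap : ∀ a x y → a * x * y ≡ a * y * x
      swap = solve-∀
      swap′ : ∀ a x y → a * x * y ≡ a * (y * x)
      swap′ = solve-∀
    bound : q ^ suc s * sumFin (λ i → α i * prod< (suc s) (λ b → g i b (c b)))
              ≤ sumFin (λ i → α i * prod< (suc s) (λ b → sum< q (g i b)))
    bound = begin
      q * q ^ s * sumFin (λ i → α i * (g i 0 v₀ * prod< s (λ b → g i (suc b) (c′ b))))
        ≡⟨ *-assoc q (q ^ s) _ ⟨ trans ⟩ cong (λ z → q * (q ^ s * z)) (sumFin-cong (λ i → sym (*-assoc (α i) _ _))) ⟩
      q * (q ^ s * sumFin (λ i → α i * g i 0 v₀ * prod< s (λ b → g i (suc b) (c′ b))))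
        ≤⟨ *-monoʳ-≤ q c′-below ⟩
      q * conditional-on-first q s g α v₀
        ≤⟨ v₀-below ⟩
      sum< q (conditional-on-first q s g α)
        ≡⟨ sum<-sumFin-comm q (λ i v → α i * g i 0 v * rest i) ⟩
      sumFin (λ i → sum< q (λ v → α i * g i 0 v * rest i))
        ≡⟨ sumFin-cong sum-first ⟩
      sumFin (λ i → α i * (sum< q (g i 0) * rest i)) ∎
      where open ≤-Reasoning

  -- The pessimistic estimator: rows with few hits have a large product of weights.
  weight : ℕ → Bool → ℕ
  weight N true  = N
  weight N false = suc N

  hits : ℕ → (ℕ → Bool) → ℕ
  hits s y = sum< s (λ b → indicator (y b))

  prod<-weight : ∀ N s (y : ℕ → Bool) →
    prod< s (λ b → weight N (y b)) * suc N ^ hits s y ≡ N ^ hits s y * suc N ^ s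
  prod<-weight N zero    y = refl
  prod<-weight N (suc s) y with y 0 | prod<-weight N s (λ b → y (suc b))
  ... | true  | eq = begin
    N * P * (suc N * suc N ^ h)   ≡⟨ shuffle N P (suc N) (suc N ^ h) ⟩
    N * suc N * (P * suc N ^ h)   ≡⟨ cong (N * suc N *_) eq ⟩
    N * suc N * (N ^ h * suc N ^ s) ≡⟨ shuffle N (suc N) (N ^ h) (suc N ^ s) ⟩
    N * N ^ h * (suc N * suc N ^ s) ∎
    where
    open ≡-Reasoning
    P = prod< s (λ b → weight N (y (suc b)))
    h = hits s (λ b → y (suc b))
    shuffle : ∀ a b c d → a * b * (c * d) ≡ a * c * (b * d)
    shuffle = solve-∀
  ... | false | eq = begin
    suc N * P * suc N ^ h           ≡⟨ *-assoc (suc N) P _ ⟩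
    suc N * (P * suc N ^ h)         ≡⟨ cong (suc N *_) eq ⟩
    suc N * (N ^ h * suc N ^ s)     ≡⟨ rotate (suc N) (N ^ h) (suc N ^ s) ⟩
    N ^ h * (suc N * suc N ^ s)     ∎
    where
    open ≡-Reasoning
    P = prod< s (λ b → weight N (y (suc b)))
    h = hits s (λ b → y (suc b))
    rotate : ∀ a b c → a * (b * c) ≡ b * (a * c)
    rotate = solve-∀

  prod<-weight-≥ : ∀ N s a (y : ℕ → Bool) → hits s y ≤ a →
    N ^ a * suc N ^ s ≤ prod< s (λ b → weight N (y b)) * suc N ^ a
  prod<-weight-≥ N s a y h≤a = begin
    N ^ a * suc N ^ s                  ≡⟨ cong (λ e → N ^ e * suc N ^ s) (m+[n∸m]≡n h≤a) ⟨
    N ^ (h + d) * suc N ^ s            ≡⟨ cong (_* suc N ^ s) (^-distribˡ-+-* N h d) ⟩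
    N ^ h * N ^ d * suc N ^ s          ≡⟨ swap (N ^ h) (N ^ d) (suc N ^ s) ⟩
    N ^ h * suc N ^ s * N ^ d          ≤⟨ *-monoʳ-≤ (N ^ h * suc N ^ s) (^-monoˡ-≤ d (n≤1+n N)) ⟩
    N ^ h * suc N ^ s * suc N ^ d      ≡⟨ cong (_* suc N ^ d) (prod<-weight N s y) ⟨
    G * suc N ^ h * suc N ^ d          ≡⟨ *-assoc G _ _ ⟩
    G * (suc N ^ h * suc N ^ d)        ≡⟨ cong (G *_) (^-distribˡ-+-* (suc N) h d) ⟨
    G * suc N ^ (h + d)                ≡⟨ cong (λ e → G * suc N ^ e) (m+[n∸m]≡n h≤a) ⟩
    G * suc N ^ a                      ∎
    where
    open ≤-Reasoning
    h = hits s y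
    d = a ∸ h
    G = prod< s (λ b → weight N (y b))
    swap : ∀ x y z → x * y * z ≡ x * z * y
    swap = solve-∀

  sum<-weight+hits : ∀ N q (y : ℕ → Bool) → sum< q (λ v → weight N (y v)) + hits q y ≡ suc N * q
  sum<-weight+hits N q y = begin
    sum< q (λ v → weight N (y v)) + hits q y           ≡⟨ sum<-distrib-+ q _ _ ⟨
    sum< q (λ v → weight N (y v) + indicator (y v))   ≡⟨ sum<-cong q (λ v _ → weight+indicator (y v)) ⟩
    sum< q (λ _ → suc N)                              ≡⟨ sum<-const q (suc N) ⟩
    q * suc N                                         ≡⟨ *-comm q (suc N) ⟩
    suc N * q                                         ∎
    where
    open ≡-Reasoning
    weight+indicator : ∀ β → weight N β + indicator β ≡ suc N
    weight+indicator true  = +-comm N 1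
    weight+indicator false = +-identityʳ (suc N)

  -- Markov's inequality and the union bound, applied to the estimator at the choice
  -- given by choice-below-average.
  many-hits : ∀ {m} q s a N (x : Fin m → ℕ → ℕ → Bool) → 0 < q →
    (∀ i → m * (suc N ^ a * prod< s (λ b → sum< q (λ v → weight N (x i b v)))) < q ^ s * (suc N ^ s * N ^ a)) →
    Σ[ c ∈ (ℕ → ℕ) ] ((∀ b → b < s → c b < q) × (∀ i → a < hits s (λ b → x i b (c b))))
  many-hits {m} q s a N x q>0 small
    with c , c<q , c-below ← choice-below-average q s (λ i b v → weight N (x i b v)) (λ _ → 1) q>0
    = c , c<q , many
    where
    G K : Fin m → ℕ
    G i = prod< s (λ b → weight N (x i b (c b)))
    K i = prod< s (λ b → sum< q (λ v → weight N (x i b v)))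
    C = q ^ s * (suc N ^ s * N ^ a)
    averaged : q ^ s * sumFin G ≤ sumFin K
    averaged = begin
      q ^ s * sumFin G                 ≡⟨ cong (q ^ s *_) (sumFin-cong (λ i → *-identityˡ (G i))) ⟨
      q ^ s * sumFin (λ i → 1 * G i)   ≤⟨ c-below ⟩
      sumFin (λ i → 1 * K i)           ≡⟨ sumFin-cong (λ i → *-identityˡ (K i)) ⟩
      sumFin K                         ∎
      where open ≤-Reasoning
    union : ∀ i → suc N ^ a * sumFin K < C
    union i = subst (_< C) (sumFin-*ˡ (suc N ^ a) K) (sumFin<-by-terms (λ j → suc N ^ a * K j) small i)
    C≤ : ∀ i → hits s (λ b → x i b (c b)) ≤ a → C ≤ suc N ^ a * sumFin K
    C≤ i few = begin
      q ^ s * (suc N ^ s * N ^ a)       ≡⟨ cong (q ^ s *_) (*-comm (suc N ^ s) (N ^ a)) ⟩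
      q ^ s * (N ^ a * suc N ^ s)       ≤⟨ *-monoʳ-≤ (q ^ s) (prod<-weight-≥ N s a _ few) ⟩
      q ^ s * (G i * suc N ^ a)         ≤⟨ *-monoʳ-≤ (q ^ s) (*-monoˡ-≤ (suc N ^ a) (f≤sumFin G i)) ⟩
      q ^ s * (sumFin G * suc N ^ a)    ≡⟨ *-assoc (q ^ s) _ _ ⟨
      q ^ s * sumFin G * suc N ^ a      ≤⟨ *-monoˡ-≤ (suc N ^ a) averaged ⟩
      sumFin K * suc N ^ a              ≡⟨ *-comm (sumFin K) _ ⟩
      suc N ^ a * sumFin K              ∎
      where open ≤-Reasoning
    many : ∀ i → a < hits s (λ b → x i b (c b))
    many i = ≰⇒> (λ few → <⇒≱ (union i) (C≤ i few))


module PowerBounds where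

  open import Data.Nat
  open import Data.Nat.Properties
  open import Relation.Binary.PropositionalEquality
  open import Relation.Nullary using (yes; no; contradiction)
  open import Data.Nat.Tactic.RingSolver using (solve-∀)

  ^-distribʳ-* : ∀ a b n → (a * b) ^ n ≡ a ^ n * b ^ n
  ^-distribʳ-* a b zero    = refl
  ^-distribʳ-* a b (suc n) = trans (cong (a * b *_) (^-distribʳ-* a b n)) (shuffle a b (a ^ n) (b ^ n))
    where
    shuffle : ∀ a b x y → a * b * (x * y) ≡ a * x * (b * y)
    shuffle = solve-∀

  *-cancelʳ-≤-pos : ∀ {a b c} → 0 < c → a * c ≤ b * c → a ≤ b
  *-cancelʳ-≤-pos {a} {b} {c} c>0 = *-cancelʳ-≤ a b c {{>-nonZero c>0}}

  ^-pos : ∀ {x} n → 0 < x → 0 < x ^ n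
  ^-pos n x>0 = m^n>0 _ {{>-nonZero x>0}} n

  suc^≤*^-downward : ∀ {n k d c} → 0 < n → d ≤ k → suc n ^ k ≤ c * n ^ k → suc n ^ d ≤ c * n ^ d
  suc^≤*^-downward {n} {k} {d} {c} n>0 d≤k le = *-cancelʳ-≤-pos (^-pos e n>0) (begin
    suc n ^ d * n ^ e       ≤⟨ *-monoʳ-≤ (suc n ^ d) (^-monoˡ-≤ e (n≤1+n n)) ⟩
    suc n ^ d * suc n ^ e   ≡⟨ ^-distribˡ-+-* (suc n) d e ⟨
    suc n ^ (d + e)         ≡⟨ cong (suc n ^_) d+e≡k ⟩
    suc n ^ k               ≤⟨ le ⟩
    c * n ^ k               ≡⟨ cong (λ z → c * n ^ z) d+e≡k ⟨
    c * n ^ (d + e)         ≡⟨ cong (c *_) (^-distribˡ-+-* n d e) ⟩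
    c * (n ^ d * n ^ e)     ≡⟨ *-assoc c _ _ ⟨
    c * n ^ d * n ^ e       ∎)
    where
    open ≤-Reasoning
    e = k ∸ d
    d+e≡k : d + e ≡ k
    d+e≡k = m+[n∸m]≡n d≤k

  -- (1 + 1/x)^k ≥ 1 + k/x, cleared of denominators.
  bernoulli : ∀ x k → x ^ k * (x + k) ≤ suc x ^ k * x
  bernoulli x zero    = ≤-reflexive (cong (_+ 0) (+-identityʳ x))
  bernoulli x (suc k) = begin
    x * x ^ k * (x + suc k)                    ≡⟨ expand x (x ^ k) k ⟩
    x ^ k * (x + k) * x + x ^ k * x            ≤⟨ +-monoˡ-≤ (x ^ k * x) (*-monoˡ-≤ x (bernoulli x k)) ⟩
    suc x ^ k * x * x + x ^ k * x              ≤⟨ +-monoʳ-≤ (suc x ^ k * x * x) (*-monoˡ-≤ x (^-monoˡ-≤ k (n≤1+n x))) ⟩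
    suc x ^ k * x * x + suc x ^ k * x          ≡⟨ collect (suc x ^ k) x ⟩
    suc x * suc x ^ k * x                      ∎
    where
    open ≤-Reasoning
    expand : ∀ x y k → x * y * (x + suc k) ≡ y * (x + k) * x + y * x
    expand = solve-∀
    collect : ∀ z x → z * x * x + z * x ≡ suc x * z * x
    collect = solve-∀

  -- (1 + 1/Y)^k ≤ (Y + 1)/(d + 1) for Y = k + d, cleared of denominators.
  bernoulli-reverse : ∀ k d → suc (k + d) ^ k * suc d ≤ (k + d) ^ k * suc (k + d)
  bernoulli-reverse zero    d = ≤-refl
  bernoulli-reverse (suc k) d = begin
    Y₁ * Y₁ ^ k * suc d           ≡⟨ rotate Y₁ (Y₁ ^ k) (suc d) ⟩
    Y₁ ^ k * (Y₁ * suc d)         ≤⟨ *-monoʳ-≤ (Y₁ ^ k) step ⟩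
    Y₁ ^ k * (Y * suc (suc d))    ≡⟨ swap (Y₁ ^ k) Y (suc (suc d)) ⟩
    Y * (Y₁ ^ k * suc (suc d))    ≤⟨ *-monoʳ-≤ Y ih ⟩
    Y * (Y ^ k * Y₁)              ≡⟨ *-assoc Y (Y ^ k) Y₁ ⟨
    Y * Y ^ k * Y₁                ∎
    where
    open ≤-Reasoning
    Y = suc (k + d)
    Y₁ = suc Y
    ih : Y₁ ^ k * suc (suc d) ≤ Y ^ k * Y₁
    ih = subst (λ z → suc z ^ k * suc (suc d) ≤ z ^ k * suc z) (+-suc k d) (bernoulli-reverse k (suc d))
    rotate : ∀ a b c → a * b * c ≡ b * (a * c)
    rotate = solve-∀
    swap : ∀ a b c → a * (b * c) ≡ b * (a * c)
    swap = solve-∀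
    expand : ∀ k d → suc (suc (k + d)) * suc d ≡ suc (k + d) * suc d + suc d
    expand = solve-∀
    collect : ∀ k d → suc (k + d) * suc d + suc (k + d) ≡ suc (k + d) * suc (suc d)
    collect = solve-∀
    step : Y₁ * suc d ≤ Y * suc (suc d)
    step = begin
      Y₁ * suc d            ≡⟨ expand k d ⟩
      Y * suc d + suc d     ≤⟨ +-monoʳ-≤ (Y * suc d) (s≤s (m≤n+m d k)) ⟩
      Y * suc d + Y         ≡⟨ collect k d ⟩
      Y * suc (suc d)       ∎

  *-self-≤⇒≤ : ∀ {a b} → a * a ≤ b * b → a ≤ b
  *-self-≤⇒≤ {a} {b} a²≤b² with a ≤? b
  ... | yes a≤b = a≤b
  ... | no  a≰b = contradiction a²≤b² (<⇒≱ (*-mono-< (≰⇒> a≰b) (≰⇒> a≰b)))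

  ⌈n/2⌉≤1+⌊n/2⌋ : ∀ n → ⌈ n /2⌉ ≤ suc ⌊ n /2⌋
  ⌈n/2⌉≤1+⌊n/2⌋ zero          = z≤n
  ⌈n/2⌉≤1+⌊n/2⌋ (suc zero)    = ≤-refl
  ⌈n/2⌉≤1+⌊n/2⌋ (suc (suc n)) = s≤s (⌈n/2⌉≤1+⌊n/2⌋ n)

  -- Each half of the exponent contributes a factor at most 2, by bernoulli-reverse.
  [1+n]^n≤4*n^n : ∀ n → suc n ^ n ≤ 4 * n ^ n
  [1+n]^n≤4*n^n zero      = s≤s z≤n
  [1+n]^n≤4*n^n n@(suc _) = begin
    suc n ^ n                   ≡⟨ cong (suc n ^_) k+d≡n ⟨
    suc n ^ (k + d)             ≡⟨ ^-distribˡ-+-* (suc n) k d ⟩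
    suc n ^ k * suc n ^ d       ≤⟨ *-mono-≤ half-k half-d ⟩
    2 * n ^ k * (2 * n ^ d)     ≡⟨ collect (n ^ k) (n ^ d) ⟩
    4 * (n ^ k * n ^ d)         ≡⟨ cong (4 *_) (^-distribˡ-+-* n k d) ⟨
    4 * n ^ (k + d)             ≡⟨ cong (λ e → 4 * n ^ e) k+d≡n ⟩
    4 * n ^ n                   ∎
    where
    open ≤-Reasoning
    k = ⌈ n /2⌉
    d = ⌊ n /2⌋
    k+d≡n : k + d ≡ n
    k+d≡n = trans (+-comm k d) (⌊n/2⌋+⌈n/2⌉≡n n)
    collect : ∀ a b → 2 * a * (2 * b) ≡ 4 * (a * b)
    collect = solve-∀
    twice : ∀ a b → a * (2 * b) ≡ 2 * (a * b)
    twice = solve-∀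
    double : ∀ d → suc (suc d + d) ≡ 2 * suc d
    double = solve-∀
    1+n≤2[1+d] : suc n ≤ 2 * suc d
    1+n≤2[1+d] = begin
      suc n            ≡⟨ cong suc k+d≡n ⟨
      suc (k + d)      ≤⟨ s≤s (+-monoˡ-≤ d (⌈n/2⌉≤1+⌊n/2⌋ n)) ⟩
      suc (suc d + d)  ≡⟨ double d ⟩
      2 * suc d        ∎
    half-k : suc n ^ k ≤ 2 * n ^ k
    half-k = *-cancelʳ-≤-pos {c = suc n} z<s (begin
      suc n ^ k * suc n           ≤⟨ *-monoʳ-≤ (suc n ^ k) 1+n≤2[1+d] ⟩
      suc n ^ k * (2 * suc d)     ≡⟨ twice (suc n ^ k) (suc d) ⟩
      2 * (suc n ^ k * suc d)     ≤⟨ *-monoʳ-≤ 2 (subst (λ m → suc m ^ k * suc d ≤ m ^ k * suc m) k+d≡n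
                                                         (bernoulli-reverse k d)) ⟩
      2 * (n ^ k * suc n)         ≡⟨ *-assoc 2 (n ^ k) (suc n) ⟨
      2 * n ^ k * suc n           ∎)
    half-d : suc n ^ d ≤ 2 * n ^ d
    half-d = suc^≤*^-downward {n = n} {c = 2} z<s (⌊n/2⌋≤⌈n/2⌉ n) half-k

  [1+2h]^h≤2*[2h]^h : ∀ h → suc (2 * h) ^ h ≤ 2 * (2 * h) ^ h
  [1+2h]^h≤2*[2h]^h h = *-self-≤⇒≤ (begin
    suc P ^ h * suc P ^ h       ≡⟨ ^-distribˡ-+-* (suc P) h h ⟨
    suc P ^ (h + h)             ≡⟨ cong (suc P ^_) h+h≡P ⟩
    suc P ^ P                   ≤⟨ [1+n]^n≤4*n^n P ⟩
    4 * P ^ P                   ≡⟨ cong (λ e → 4 * P ^ e) h+h≡P ⟨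
    4 * P ^ (h + h)             ≡⟨ cong (4 *_) (^-distribˡ-+-* P h h) ⟩
    4 * (P ^ h * P ^ h)         ≡⟨ collect (P ^ h) ⟩
    2 * P ^ h * (2 * P ^ h)     ∎)
    where
    open ≤-Reasoning
    P = 2 * h
    h+h≡P : h + h ≡ P
    h+h≡P = cong (h +_) (sym (+-identityʳ h))
    collect : ∀ a → 4 * (a * a) ≡ 2 * a * (2 * a)
    collect = solve-∀

  x^k≤y⇒x^[k*J]≤y^J : ∀ {x y} k J → x ^ k ≤ y → x ^ (k * J) ≤ y ^ J
  x^k≤y⇒x^[k*J]≤y^J {x} k J le = subst (_≤ _) (^-*-assoc x k J) (^-monoˡ-≤ J le)

  [1+2h]^a≤2^J*[2h]^a : ∀ h J a → 0 < h → a ≤ h * J → suc (2 * h) ^ a ≤ 2 ^ J * (2 * h) ^ a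
  [1+2h]^a≤2^J*[2h]^a h J a h>0 a≤hJ = suc^≤*^-downward {n = 2 * h} {c = 2 ^ J} (*-mono-≤ {1} {2} (s≤s z≤n) h>0) a≤hJ (begin
    suc (2 * h) ^ (h * J)                ≤⟨ x^k≤y⇒x^[k*J]≤y^J h J ([1+2h]^h≤2*[2h]^h h) ⟩
    (2 * (2 * h) ^ h) ^ J                ≡⟨ ^-distribʳ-* 2 _ J ⟩
    2 ^ J * ((2 * h) ^ h) ^ J            ≡⟨ cong (2 ^ J *_) (^-*-assoc (2 * h) h J) ⟩
    2 ^ J * (2 * h) ^ (h * J)            ∎)
    where open ≤-Reasoning

  2^J*x^[x*J]≤[1+x]^[x*J] : ∀ x J → 0 < x → 2 ^ J * x ^ (x * J) ≤ suc x ^ (x * J)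
  2^J*x^[x*J]≤[1+x]^[x*J] x J x>0 = begin
    2 ^ J * x ^ (x * J)           ≡⟨ cong (2 ^ J *_) (^-*-assoc x x J) ⟨
    2 ^ J * (x ^ x) ^ J           ≡⟨ ^-distribʳ-* 2 (x ^ x) J ⟨
    (2 * x ^ x) ^ J               ≤⟨ ^-monoˡ-≤ J doubling ⟩
    (suc x ^ x) ^ J               ≡⟨ ^-*-assoc (suc x) x J ⟩
    suc x ^ (x * J)               ∎
    where
    open ≤-Reasoning
    twice : ∀ a b → 2 * a * b ≡ a * (b + b)
    twice = solve-∀
    doubling : 2 * x ^ x ≤ suc x ^ x
    doubling = *-cancelʳ-≤-pos x>0 (begin
      2 * x ^ x * x      ≡⟨ twice (x ^ x) x ⟩
      x ^ x * (x + x)    ≤⟨ bernoulli x x ⟩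
      suc x ^ x * x      ∎)

  n^n≤4^n*n! : ∀ n → n ^ n ≤ 4 ^ n * n !
  n^n≤4^n*n! zero    = s≤s z≤n
  n^n≤4^n*n! (suc n) = begin
    suc n * suc n ^ n               ≤⟨ *-monoʳ-≤ (suc n) ([1+n]^n≤4*n^n n) ⟩
    suc n * (4 * n ^ n)             ≤⟨ *-monoʳ-≤ (suc n) (*-monoʳ-≤ 4 (n^n≤4^n*n! n)) ⟩
    suc n * (4 * (4 ^ n * n !))     ≡⟨ regroup (suc n) (4 ^ n) (n !) ⟩
    4 * 4 ^ n * (suc n * n !)       ∎
    where
    open ≤-Reasoning
    regroup : ∀ a b c → a * (4 * (b * c)) ≡ 4 * b * (a * c)
    regroup = solve-∀

  m!*m^n≤[m+n]! : ∀ m n → m ! * m ^ n ≤ (m + n) !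
  m!*m^n≤[m+n]! m zero    = ≤-reflexive (trans (*-identityʳ _) (cong _! (sym (+-identityʳ m))))
  m!*m^n≤[m+n]! m (suc n) = begin
    m ! * (m * m ^ n)           ≡⟨ swap (m !) m (m ^ n) ⟩
    m * (m ! * m ^ n)           ≤⟨ *-mono-≤ (≤-trans (m≤m+n m n) (n≤1+n _)) (m!*m^n≤[m+n]! m n) ⟩
    suc (m + n) * (m + n) !     ≡⟨ cong _! (+-suc m n) ⟨
    (m + suc n) !               ∎
    where
    open ≤-Reasoning
    swap : ∀ a b c → a * (b * c) ≡ b * (a * c)
    swap = solve-∀

  [m+n]!≤m!*[m+n]^n : ∀ m n → (m + n) ! ≤ m ! * (m + n) ^ n
  [m+n]!≤m!*[m+n]^n m zero    = ≤-reflexive (trans (cong _! (+-identityʳ m)) (sym (*-identityʳ _)))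
  [m+n]!≤m!*[m+n]^n m (suc n) = begin
    (m + suc n) !                         ≡⟨ cong _! (+-suc m n) ⟩
    suc (m + n) * (m + n) !               ≤⟨ *-monoʳ-≤ (suc (m + n)) ([m+n]!≤m!*[m+n]^n m n) ⟩
    suc (m + n) * (m ! * (m + n) ^ n)     ≤⟨ *-monoʳ-≤ (suc (m + n)) (*-monoʳ-≤ (m !) (^-monoˡ-≤ n (n≤1+n _))) ⟩
    suc (m + n) * (m ! * suc (m + n) ^ n) ≡⟨ swap (suc (m + n)) (m !) _ ⟩
    m ! * (suc (m + n) * suc (m + n) ^ n) ≡⟨ cong (λ x → m ! * (x * x ^ n)) (+-suc m n) ⟨
    m ! * ((m + suc n) * (m + suc n) ^ n) ∎
    where
    open ≤-Reasoning
    swap : ∀ a b c → a * (b * c) ≡ b * (a * c)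
    swap = solve-∀

  Y^i*Y!≤Y^Y*i! : ∀ Y i → Y ^ i * Y ! ≤ Y ^ Y * i !
  Y^i*Y!≤Y^Y*i! Y i with i ≤? Y
  ... | yes i≤Y = begin
    Y ^ i * Y !                 ≡⟨ cong (λ x → Y ^ i * x !) i+j≡Y ⟨
    Y ^ i * (i + j) !           ≤⟨ *-monoʳ-≤ (Y ^ i) ([m+n]!≤m!*[m+n]^n i j) ⟩
    Y ^ i * (i ! * (i + j) ^ j) ≡⟨ cong (λ x → Y ^ i * (i ! * x ^ j)) i+j≡Y ⟩
    Y ^ i * (i ! * Y ^ j)       ≡⟨ swap (Y ^ i) (i !) (Y ^ j) ⟩
    Y ^ i * Y ^ j * i !         ≡⟨ cong (_* i !) (^-distribˡ-+-* Y i j) ⟨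
    Y ^ (i + j) * i !           ≡⟨ cong (λ x → Y ^ x * i !) i+j≡Y ⟩
    Y ^ Y * i !                 ∎
    where
    open ≤-Reasoning
    j = Y ∸ i
    i+j≡Y : i + j ≡ Y
    i+j≡Y = m+[n∸m]≡n i≤Y
    swap : ∀ a b c → a * (b * c) ≡ a * c * b
    swap = solve-∀
  ... | no i≰Y = begin
    Y ^ i * Y !                 ≡⟨ cong (λ x → Y ^ x * Y !) Y+j≡i ⟨
    Y ^ (Y + j) * Y !           ≡⟨ cong (_* Y !) (^-distribˡ-+-* Y Y j) ⟩
    Y ^ Y * Y ^ j * Y !         ≡⟨ swap (Y ^ Y) (Y ^ j) (Y !) ⟩
    Y ^ Y * (Y ! * Y ^ j)       ≤⟨ *-monoʳ-≤ (Y ^ Y) (m!*m^n≤[m+n]! Y j) ⟩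
    Y ^ Y * (Y + j) !           ≡⟨ cong (λ x → Y ^ Y * x !) Y+j≡i ⟩
    Y ^ Y * i !                 ∎
    where
    open ≤-Reasoning
    j = i ∸ Y
    Y+j≡i : Y + j ≡ i
    Y+j≡i = m+[n∸m]≡n (<⇒≤ (≰⇒> i≰Y))
    swap : ∀ a b c → a * b * c ≡ a * (c * b)
    swap = solve-∀

  Y^i≤4^Y*i! : ∀ Y i → Y ^ i ≤ 4 ^ Y * i !
  Y^i≤4^Y*i! Y i = *-cancelʳ-≤ _ _ (Y !) {{Y !≢0}} (begin
    Y ^ i * Y !             ≤⟨ Y^i*Y!≤Y^Y*i! Y i ⟩
    Y ^ Y * i !             ≤⟨ *-monoˡ-≤ (i !) (n^n≤4^n*n! Y) ⟩
    4 ^ Y * Y ! * i !       ≡⟨ swap (4 ^ Y) (Y !) (i !) ⟩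
    4 ^ Y * i ! * Y !       ∎)
    where
    open ≤-Reasoning
    swap : ∀ a b c → a * b * c ≡ a * c * b
    swap = solve-∀


module ChernoffBound where

  open import Data.Nat
  open import Data.Nat.Properties
  open import Relation.Binary.PropositionalEquality
  open import Data.Nat.Tactic.RingSolver using (solve-∀)
  open FiniteSums using (prod<; sum<)
  open PowerBounds

  -- 1 - k/Q ≤ (1 + 1/Q)^(-k), cleared of denominators.
  c*[1+Q]^k≤Q^[1+k] : ∀ Q k c → c + k ≡ Q → c * suc Q ^ k ≤ Q ^ suc k
  c*[1+Q]^k≤Q^[1+k] Q zero    c c+0≡Q = ≤-reflexive (cong (_* 1) (trans (sym (+-identityʳ c)) c+0≡Q))
  c*[1+Q]^k≤Q^[1+k] Q (suc k) c c+k≡Q = begin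
    c * (suc Q * suc Q ^ k)     ≡⟨ *-assoc c (suc Q) _ ⟨
    c * suc Q * suc Q ^ k       ≤⟨ *-monoˡ-≤ (suc Q ^ k) step ⟩
    Q * suc c * suc Q ^ k       ≡⟨ *-assoc Q (suc c) _ ⟩
    Q * (suc c * suc Q ^ k)     ≤⟨ *-monoʳ-≤ Q (c*[1+Q]^k≤Q^[1+k] Q k (suc c) (trans (sym (+-suc c k)) c+k≡Q)) ⟩
    Q * Q ^ suc k               ∎
    where
    open ≤-Reasoning
    c≤Q : c ≤ Q
    c≤Q = subst (c ≤_) c+k≡Q (m≤m+n c (suc k))
    step : c * suc Q ≤ Q * suc c
    step = begin
      c * suc Q     ≡⟨ *-suc c Q ⟩
      c + c * Q     ≤⟨ +-monoˡ-≤ (c * Q) c≤Q ⟩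
      Q + c * Q     ≡⟨ cong (Q +_) (*-comm c Q) ⟩
      Q + Q * c     ≡⟨ *-suc Q c ⟨
      Q * suc c     ∎

  prod<-*[1+Q]^sum<≤Q^ : ∀ Q s (c k : ℕ → ℕ) → (∀ b → c b + k b ≡ Q) →
    prod< s c * suc Q ^ sum< s k ≤ Q ^ (s + sum< s k)
  prod<-*[1+Q]^sum<≤Q^ Q zero    c k c+k≡Q = ≤-refl
  prod<-*[1+Q]^sum<≤Q^ Q (suc s) c k c+k≡Q = begin
    c 0 * P * suc Q ^ (k 0 + K)                 ≡⟨ cong (c 0 * P *_) (^-distribˡ-+-* (suc Q) (k 0) K) ⟩
    c 0 * P * (suc Q ^ k 0 * suc Q ^ K)         ≡⟨ shuffle (c 0) P (suc Q ^ k 0) (suc Q ^ K) ⟩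
    (c 0 * suc Q ^ k 0) * (P * suc Q ^ K)       ≤⟨ *-mono-≤ (c*[1+Q]^k≤Q^[1+k] Q (k 0) (c 0) (c+k≡Q 0))
                                                            (prod<-*[1+Q]^sum<≤Q^ Q s _ _ (λ b → c+k≡Q (suc b))) ⟩
    Q ^ suc (k 0) * Q ^ (s + K)                 ≡⟨ ^-distribˡ-+-* Q (suc (k 0)) (s + K) ⟨
    Q ^ (suc (k 0) + (s + K))                   ≡⟨ cong (Q ^_) (exchange (k 0) s K) ⟩
    Q ^ (suc s + (k 0 + K))                     ∎
    where
    open ≤-Reasoning
    P = prod< s (λ b → c (suc b))
    K = sum< s (λ b → k (suc b))
    shuffle : ∀ a b x y → a * b * (x * y) ≡ (a * x) * (b * y)
    shuffle = solve-∀
    exchange : ∀ a b c → suc a + (b + c) ≡ suc b + (a + c)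
    exchange = solve-∀

  -- (1 + 1/Q)^q ≥ 1 + 1/(N+1) for Q = (N+1) q, raised to the power μ.
  bernoulli-blocks : ∀ N q μ K → 0 < q → q * μ ≤ K →
    (suc N * q) ^ K * suc (suc N) ^ μ ≤ suc (suc N * q) ^ K * suc N ^ μ
  bernoulli-blocks N q zero    K q>0 _    = *-monoˡ-≤ 1 (^-monoˡ-≤ K (n≤1+n (suc N * q)))
  bernoulli-blocks N q (suc μ) K q>0 qμ≤K =
    subst (λ L → Q ^ L * suc (suc N) ^ suc μ ≤ suc Q ^ L * suc N ^ suc μ) (m+[n∸m]≡n q≤K) (begin
    Q ^ (q + K′) * (suc (suc N) * suc (suc N) ^ μ)           ≡⟨ cong (_* _) (^-distribˡ-+-* Q q K′) ⟩
    Q ^ q * Q ^ K′ * (suc (suc N) * suc (suc N) ^ μ)         ≡⟨ shuffle (Q ^ q) (Q ^ K′) (suc (suc N)) (suc (suc N) ^ μ) ⟩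
    (Q ^ q * suc (suc N)) * (Q ^ K′ * suc (suc N) ^ μ)       ≤⟨ *-mono-≤ one-block (bernoulli-blocks N q μ K′ q>0 qμ≤K′) ⟩
    (suc Q ^ q * suc N) * (suc Q ^ K′ * suc N ^ μ)           ≡⟨ shuffle (suc Q ^ q) (suc Q ^ K′) (suc N) (suc N ^ μ) ⟨
    suc Q ^ q * suc Q ^ K′ * (suc N * suc N ^ μ)             ≡⟨ cong (_* _) (^-distribˡ-+-* (suc Q) q K′) ⟨
    suc Q ^ (q + K′) * (suc N * suc N ^ μ)                   ∎)
    where
    open ≤-Reasoning
    Q = suc N * q
    K′ = K ∸ q
    q+qμ≤K : q + q * μ ≤ K
    q+qμ≤K = subst (_≤ K) (*-suc q μ) qμ≤K
    q≤K : q ≤ K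
    q≤K = ≤-trans (m≤m+n q (q * μ)) q+qμ≤K
    qμ≤K′ : q * μ ≤ K′
    qμ≤K′ = subst (_≤ K′) (m+n∸m≡n q (q * μ)) (∸-monoˡ-≤ q q+qμ≤K)
    shuffle : ∀ a b x y → a * b * (x * y) ≡ (a * x) * (b * y)
    shuffle = solve-∀
    extra : ∀ N q → suc (suc N) * q ≡ suc N * q + q
    extra = solve-∀
    one-block : Q ^ q * suc (suc N) ≤ suc Q ^ q * suc N
    one-block = *-cancelʳ-≤-pos q>0 (begin
      Q ^ q * suc (suc N) * q      ≡⟨ *-assoc (Q ^ q) _ q ⟩
      Q ^ q * (suc (suc N) * q)    ≡⟨ cong (Q ^ q *_) (extra N q) ⟩
      Q ^ q * (Q + q)              ≤⟨ bernoulli Q q ⟩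
      suc Q ^ q * Q                ≡⟨ *-assoc (suc Q ^ q) (suc N) q ⟨
      suc Q ^ q * suc N * q        ∎)

  -- m ((N+1)² / (N (N+2)))^a < ((N+2) / (N+1))^((N+1) J′), cleared of denominators.
  tail-bound : ∀ N a m h J J′ → 0 < h → N * suc (suc N) ≡ 2 * h → a ≤ h * J → m * 2 ^ J < 2 ^ J′ →
    m * suc N ^ (a + (a + suc N * J′)) < N ^ a * suc (suc N) ^ (a + suc N * J′)
  tail-bound N a m h J J′ h>0 N[N+2]≡2h a≤hJ m2^J<2^J′ = begin-strict
    m * sN ^ (a + (a + λ′))                     ≡⟨ cong (m *_) split ⟩
    m * (sN ^ a * sN ^ a * sN ^ λ′)             ≤⟨ *-monoʳ-≤ m (*-monoˡ-≤ (sN ^ λ′) square) ⟩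
    m * (2 ^ J * P ^ a * sN ^ λ′)               ≡⟨ regroup m (2 ^ J) (P ^ a) (sN ^ λ′) ⟩
    m * 2 ^ J * (P ^ a * sN ^ λ′)               <⟨ *-monoˡ-< (P ^ a * sN ^ λ′) {{>-nonZero pos}} m2^J<2^J′ ⟩
    2 ^ J′ * (P ^ a * sN ^ λ′)                  ≡⟨ swap (2 ^ J′) (P ^ a) (sN ^ λ′) ⟩
    P ^ a * (2 ^ J′ * sN ^ λ′)                  ≤⟨ *-monoʳ-≤ (P ^ a) (2^J*x^[x*J]≤[1+x]^[x*J] sN J′ z<s) ⟩
    P ^ a * ssN ^ λ′                            ≡⟨ cong (_* ssN ^ λ′) (^-distribʳ-* N ssN a) ⟩
    N ^ a * ssN ^ a * ssN ^ λ′                  ≡⟨ *-assoc (N ^ a) _ _ ⟩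
    N ^ a * (ssN ^ a * ssN ^ λ′)                ≡⟨ cong (N ^ a *_) (^-distribˡ-+-* ssN a λ′) ⟨
    N ^ a * ssN ^ (a + λ′)                      ∎
    where
    open ≤-Reasoning
    sN = suc N
    ssN = suc (suc N)
    P = N * ssN
    λ′ = sN * J′
    regroup : ∀ m x y z → m * (x * y * z) ≡ m * x * (y * z)
    regroup = solve-∀
    swap : ∀ x y z → x * (y * z) ≡ y * (x * z)
    swap = solve-∀
    1+P≡sN*sN : ∀ N → suc (N * suc (suc N)) ≡ suc N * suc N
    1+P≡sN*sN = solve-∀
    split : sN ^ (a + (a + λ′)) ≡ sN ^ a * sN ^ a * sN ^ λ′
    split = begin-equality
      sN ^ (a + (a + λ′))         ≡⟨ cong (sN ^_) (+-assoc a a λ′) ⟨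
      sN ^ (a + a + λ′)           ≡⟨ ^-distribˡ-+-* sN (a + a) λ′ ⟩
      sN ^ (a + a) * sN ^ λ′      ≡⟨ cong (_* sN ^ λ′) (^-distribˡ-+-* sN a a) ⟩
      sN ^ a * sN ^ a * sN ^ λ′   ∎
    square : sN ^ a * sN ^ a ≤ 2 ^ J * P ^ a
    square = begin
      sN ^ a * sN ^ a             ≡⟨ ^-distribʳ-* sN sN a ⟨
      (sN * sN) ^ a               ≡⟨ cong (_^ a) (1+P≡sN*sN N) ⟨
      suc P ^ a                   ≡⟨ cong (λ x → suc x ^ a) N[N+2]≡2h ⟩
      suc (2 * h) ^ a             ≤⟨ [1+2h]^a≤2^J*[2h]^a h J a h>0 a≤hJ ⟩
      2 ^ J * (2 * h) ^ a         ≡⟨ cong (λ x → 2 ^ J * x ^ a) N[N+2]≡2h ⟨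
      2 ^ J * P ^ a               ∎
    pos : 0 < P ^ a * sN ^ λ′
    pos = *-mono-< (^-pos a (subst (0 <_) (sym N[N+2]≡2h) (*-mono-≤ {1} {2} (s≤s z≤n) h>0))) (^-pos λ′ z<s)

  -- The Chernoff bound: in block b the weights of a row sum to c b = (N+1) q - k b, where k b
  -- counts its hits there, and enough hits in total push the estimator of many-hits below
  -- its threshold.
  estimator-bound : ∀ N q s a m h J J′ (c k : ℕ → ℕ) → 0 < q → 0 < h →
    N * suc (suc N) ≡ 2 * h → a ≤ h * J → m * 2 ^ J < 2 ^ J′ →
    (∀ b → c b + k b ≡ suc N * q) → q * (a + suc N * J′) ≤ sum< s k →
    m * (suc N ^ a * prod< s c) < q ^ s * (suc N ^ s * N ^ a)
  estimator-bound N q s a m h J J′ c k q>0 h>0 N[N+2]≡2h a≤hJ m2^J<2^J′ c+k≡Q enough =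
    *-cancelʳ-< _ _ _ (begin-strict
    m * (sN ^ a * prod< s c) * (suc Q ^ K * sN ^ μ)   ≡⟨ regroup m (sN ^ a) (prod< s c) (suc Q ^ K) (sN ^ μ) ⟩
    m * (sN ^ a * sN ^ μ) * (prod< s c * suc Q ^ K)   ≡⟨ cong (λ x → m * x * (prod< s c * suc Q ^ K)) (^-distribˡ-+-* sN a μ) ⟨
    m * sN ^ (a + μ) * (prod< s c * suc Q ^ K)        ≤⟨ *-monoʳ-≤ (m * sN ^ (a + μ)) (prod<-*[1+Q]^sum<≤Q^ Q s c k c+k≡Q) ⟩
    m * sN ^ (a + μ) * Q ^ (s + K)                    <⟨ *-monoˡ-< (Q ^ (s + K)) {{>-nonZero (^-pos (s + K) Q>0)}}
                                                                    (tail-bound N a m h J J′ h>0 N[N+2]≡2h a≤hJ m2^J<2^J′) ⟩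
    N ^ a * ssN ^ μ * Q ^ (s + K)                     ≡⟨ cong (N ^ a * ssN ^ μ *_) (^-distribˡ-+-* Q s K) ⟩
    N ^ a * ssN ^ μ * (Q ^ s * Q ^ K)                 ≡⟨ shuffle (N ^ a) (ssN ^ μ) (Q ^ s) (Q ^ K) ⟩
    N ^ a * Q ^ s * (Q ^ K * ssN ^ μ)                 ≤⟨ *-monoʳ-≤ (N ^ a * Q ^ s) (bernoulli-blocks N q μ K q>0 enough) ⟩
    N ^ a * Q ^ s * (suc Q ^ K * sN ^ μ)              ≡⟨ cong (λ x → N ^ a * x * (suc Q ^ K * sN ^ μ)) (^-distribʳ-* sN q s) ⟩
    N ^ a * (sN ^ s * q ^ s) * (suc Q ^ K * sN ^ μ)   ≡⟨ cong (_* (suc Q ^ K * sN ^ μ)) (reverse (N ^ a) (sN ^ s) (q ^ s)) ⟩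
    q ^ s * (sN ^ s * N ^ a) * (suc Q ^ K * sN ^ μ)   ∎)
    where
    open ≤-Reasoning
    sN = suc N
    ssN = suc (suc N)
    μ = a + sN * J′
    Q = sN * q
    K = sum< s k
    Q>0 : 0 < Q
    Q>0 = *-mono-≤ {1} {sN} (s≤s z≤n) q>0
    regroup : ∀ m x p y z → m * (x * p) * (y * z) ≡ m * (x * z) * (p * y)
    regroup = solve-∀
    shuffle : ∀ x y z w → x * y * (z * w) ≡ x * z * (w * y)
    shuffle = solve-∀
    reverse : ∀ x y z → x * (y * z) ≡ z * (y * x)
    reverse = solve-∀


module NatCast where

  open import Data.Nat as ℕ using (ℕ; zero; suc)
  import Data.Nat.Properties as ℕ
  import Data.Integer as ℤ
  import Data.Integer.Properties as ℤ
  open import Data.Rational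
  open import Data.Rational.Properties
  open import Data.Nat.Coprimality using (1-coprimeTo) renaming (sym to coprime-sym)
  open import Relation.Binary.PropositionalEquality
  open import Defs using (ℕ→ℚ)

  ℕ→ℚ≡mkℚ : ∀ n → ℕ→ℚ n ≡ mkℚ (ℤ.+ n) 0 (coprime-sym (1-coprimeTo n))
  ℕ→ℚ≡mkℚ n = normalize-coprime (coprime-sym (1-coprimeTo n))

  ℕ→ℚ-suc : ∀ n → ℕ→ℚ (suc n) ≡ 1ℚ + ℕ→ℚ n
  ℕ→ℚ-suc n = begin
    ℕ→ℚ (suc n)                        ≡⟨ cong (λ z → (ℤ.+ 1 ℤ.+ z) / 1) (ℤ.*-identityʳ (ℤ.+ n)) ⟨
    1ℚ + mkℚ (ℤ.+ n) 0 (coprime-sym (1-coprimeTo n)) ≡⟨ cong (1ℚ +_) (ℕ→ℚ≡mkℚ n) ⟨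
    1ℚ + ℕ→ℚ n                         ∎
    where open ≡-Reasoning

  ℕ→ℚ-+ : ∀ a b → ℕ→ℚ (a ℕ.+ b) ≡ ℕ→ℚ a + ℕ→ℚ b
  ℕ→ℚ-+ zero    b = sym (+-identityˡ (ℕ→ℚ b))
  ℕ→ℚ-+ (suc a) b = begin
    ℕ→ℚ (suc (a ℕ.+ b))            ≡⟨ ℕ→ℚ-suc (a ℕ.+ b) ⟩
    1ℚ + ℕ→ℚ (a ℕ.+ b)             ≡⟨ cong (1ℚ +_) (ℕ→ℚ-+ a b) ⟩
    1ℚ + (ℕ→ℚ a + ℕ→ℚ b)           ≡⟨ +-assoc 1ℚ (ℕ→ℚ a) (ℕ→ℚ b) ⟨
    1ℚ + ℕ→ℚ a + ℕ→ℚ b             ≡⟨ cong (_+ ℕ→ℚ b) (ℕ→ℚ-suc a) ⟨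
    ℕ→ℚ (suc a) + ℕ→ℚ b            ∎
    where open ≡-Reasoning

  ℕ→ℚ-* : ∀ a b → ℕ→ℚ (a ℕ.* b) ≡ ℕ→ℚ a * ℕ→ℚ b
  ℕ→ℚ-* zero    b = sym (*-zeroˡ (ℕ→ℚ b))
  ℕ→ℚ-* (suc a) b = begin
    ℕ→ℚ (b ℕ.+ a ℕ.* b)            ≡⟨ ℕ→ℚ-+ b (a ℕ.* b) ⟩
    ℕ→ℚ b + ℕ→ℚ (a ℕ.* b)          ≡⟨ cong (ℕ→ℚ b +_) (ℕ→ℚ-* a b) ⟩
    ℕ→ℚ b + ℕ→ℚ a * ℕ→ℚ b          ≡⟨ cong (_+ ℕ→ℚ a * ℕ→ℚ b) (*-identityˡ (ℕ→ℚ b)) ⟨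
    1ℚ * ℕ→ℚ b + ℕ→ℚ a * ℕ→ℚ b     ≡⟨ *-distribʳ-+ (ℕ→ℚ b) 1ℚ (ℕ→ℚ a) ⟨
    (1ℚ + ℕ→ℚ a) * ℕ→ℚ b           ≡⟨ cong (_* ℕ→ℚ b) (ℕ→ℚ-suc a) ⟨
    ℕ→ℚ (suc a) * ℕ→ℚ b            ∎
    where open ≡-Reasoning

  0≤ℕ→ℚ : ∀ n → 0ℚ ≤ ℕ→ℚ n
  0≤ℕ→ℚ n = subst (0ℚ ≤_) (sym (ℕ→ℚ≡mkℚ n)) (nonNegative⁻¹ _)

  p≤p+q : ∀ p {q} → 0ℚ ≤ q → p ≤ p + q
  p≤p+q p {q} 0≤q = subst (_≤ p + q) (+-identityʳ p) (+-monoʳ-≤ p 0≤q)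

  ℕ→ℚ-mono-≤ : ∀ {a b} → a ℕ.≤ b → ℕ→ℚ a ≤ ℕ→ℚ b
  ℕ→ℚ-mono-≤ {a} {b} a≤b = subst (ℕ→ℚ a ≤_) a+[b-a]≡b (p≤p+q (ℕ→ℚ a) (0≤ℕ→ℚ (b ℕ.∸ a)))
    where
    a+[b-a]≡b : ℕ→ℚ a + ℕ→ℚ (b ℕ.∸ a) ≡ ℕ→ℚ b
    a+[b-a]≡b = trans (sym (ℕ→ℚ-+ a (b ℕ.∸ a))) (cong ℕ→ℚ (ℕ.m+[n∸m]≡n a≤b))

  ℕ→ℚ-mono-< : ∀ {a b} → a ℕ.< b → ℕ→ℚ a < ℕ→ℚ b
  ℕ→ℚ-mono-< {a} {suc b} (ℕ.s≤s a≤b) = ≤-<-trans (ℕ→ℚ-mono-≤ a≤b) b<1+b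
    where
    b<1+b : ℕ→ℚ b < ℕ→ℚ (suc b)
    b<1+b = subst₂ _<_ (+-identityʳ (ℕ→ℚ b)) (trans (+-comm (ℕ→ℚ b) 1ℚ) (sym (ℕ→ℚ-suc b)))
                   (+-monoʳ-< (ℕ→ℚ b) (positive⁻¹ 1ℚ))

  *-nonneg : ∀ {p q} → 0ℚ ≤ p → 0ℚ ≤ q → 0ℚ ≤ p * q
  *-nonneg {p} {q} 0≤p 0≤q = nonNegative⁻¹ _ {{nonNeg*nonNeg⇒nonNeg p {{nonNegative 0≤p}} q {{nonNegative 0≤q}}}}

  *-mono-≤-nonneg : ∀ {p p′ q q′} → 0ℚ ≤ p → 0ℚ ≤ q → p ≤ p′ → q ≤ q′ → p * q ≤ p′ * q′
  *-mono-≤-nonneg {p} {p′} {q} {q′} 0≤p 0≤q p≤p′ q≤q′ =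
    ≤-trans (*-monoˡ-≤-nonNeg p {{nonNegative 0≤p}} q≤q′)
            (*-monoʳ-≤-nonNeg q′ {{nonNegative (≤-trans 0≤q q≤q′)}} p≤p′)


module ExpSeries where

  open import Data.Nat as ℕ using (ℕ; zero; suc; _!; _^_)
  import Data.Nat.Properties as ℕ
  import Data.Integer as ℤ
  open import Data.Rational
  open import Data.Rational.Properties
  open import Data.Nat.Coprimality using (1-coprimeTo) renaming (sym to coprime-sym)
  open import Data.Nat.Tactic.RingSolver using (solve-∀)
  open import Relation.Binary.PropositionalEquality
  open import Relation.Nullary using (yes; no)
  open import Function using (_⟨_⟩_)
  import Data.Rational.Solver as Solver
  open import Defs using (ℕ→ℚ; expTerm; expPartial; LeLn)
  open NatCast
  open PowerBounds using (Y^i≤4^Y*i!)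

  1/n*n≡1 : ∀ n .{{_ : ℕ.NonZero n}} → (ℤ.+ 1 / n) * ℕ→ℚ n ≡ 1ℚ
  1/n*n≡1 (suc i) = trans (cong₂ _*_ (normalize-coprime (1-coprimeTo (suc i))) (ℕ→ℚ≡mkℚ (suc i)))
                            (*-inverseˡ (mkℚ (ℤ.+ suc i) 0 (coprime-sym (1-coprimeTo (suc i)))))

  0≤1/n : ∀ n .{{_ : ℕ.NonZero n}} → 0ℚ ≤ ℤ.+ 1 / n
  0≤1/n n = nonNegative⁻¹ _ {{normalize-nonNeg 1 n}}

  expTerm-*-! : ∀ Y i → expTerm (ℕ→ℚ Y) i * ℕ→ℚ (i !) ≡ ℕ→ℚ (Y ^ i)
  expTerm-*-! Y zero    = *-identityˡ 1ℚ
  expTerm-*-! Y (suc i) = begin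
    T * y * c * ℕ→ℚ (suc i ℕ.* i !)          ≡⟨ cong (T * y * c *_) (ℕ→ℚ-* (suc i) (i !)) ⟩
    T * y * c * (ℕ→ℚ (suc i) * ℕ→ℚ (i !))    ≡⟨ regroup T y c (ℕ→ℚ (suc i)) (ℕ→ℚ (i !)) ⟩
    T * ℕ→ℚ (i !) * y * (c * ℕ→ℚ (suc i))    ≡⟨ cong₂ (λ a b → a * y * b) (expTerm-*-! Y i) (1/n*n≡1 (suc i)) ⟩
    ℕ→ℚ (Y ^ i) * y * 1ℚ                      ≡⟨ *-identityʳ _ ⟩
    ℕ→ℚ (Y ^ i) * y                           ≡⟨ *-comm (ℕ→ℚ (Y ^ i)) y ⟩
    y * ℕ→ℚ (Y ^ i)                           ≡⟨ ℕ→ℚ-* Y (Y ^ i) ⟨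
    ℕ→ℚ (Y ^ suc i)                           ∎
    where
    open ≡-Reasoning
    open Solver.+-*-Solver
    T = expTerm (ℕ→ℚ Y) i
    y = ℕ→ℚ Y
    c = ℤ.+ 1 / suc i
    regroup : ∀ a b c d e → a * b * c * (d * e) ≡ a * e * b * (c * d)
    regroup = solve 5 (λ a b c d e → a :* b :* c :* (d :* e) := a :* e :* b :* (c :* d)) refl

  expTerm-nonneg : ∀ {y} i → 0ℚ ≤ y → 0ℚ ≤ expTerm y i
  expTerm-nonneg zero    0≤y = nonNegative⁻¹ 1ℚ
  expTerm-nonneg (suc i) 0≤y = *-nonneg (*-nonneg (expTerm-nonneg i 0≤y) 0≤y) (0≤1/n (suc i))

  expTerm-mono : ∀ {y y′} i → 0ℚ ≤ y → y ≤ y′ → expTerm y i ≤ expTerm y′ i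
  expTerm-mono zero    _   _    = ≤-refl
  expTerm-mono (suc i) 0≤y y≤y′ =
    *-mono-≤-nonneg (*-nonneg (expTerm-nonneg i 0≤y) 0≤y) (0≤1/n (suc i))
      (*-mono-≤-nonneg (expTerm-nonneg i 0≤y) 0≤y (expTerm-mono i 0≤y y≤y′) y≤y′) ≤-refl

  expPartial-mono : ∀ {y y′} k → 0ℚ ≤ y → y ≤ y′ → expPartial y k ≤ expPartial y′ k
  expPartial-mono zero    _   _    = ≤-refl
  expPartial-mono (suc k) 0≤y y≤y′ = +-mono-≤ (expPartial-mono k 0≤y y≤y′) (expTerm-mono (suc k) 0≤y y≤y′)

  ≤-by-ℕ-multiples : ∀ {p q f a b} → p * ℕ→ℚ f ≡ ℕ→ℚ a → q * ℕ→ℚ f ≡ ℕ→ℚ b →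
    0 ℕ.< f → a ℕ.≤ b → p ≤ q
  ≤-by-ℕ-multiples {f = f} pf≡a qf≡b f>0 a≤b =
    *-cancelʳ-≤-pos (ℕ→ℚ f) {{positive (ℕ→ℚ-mono-< f>0)}} (subst₂ _≤_ (sym pf≡a) (sym qf≡b) (ℕ→ℚ-mono-≤ a≤b))

  expTerm≤4^Y : ∀ Y i → expTerm (ℕ→ℚ Y) i ≤ ℕ→ℚ (4 ^ Y)
  expTerm≤4^Y Y i = ≤-by-ℕ-multiples (expTerm-*-! Y i) (sym (ℕ→ℚ-* (4 ^ Y) (i !)))
                                     (ℕ.>-nonZero⁻¹ (i !) {{i ℕ.!≢0}}) (Y^i≤4^Y*i! Y i)

  2*expTerm-suc≤expTerm : ∀ Y i → 2 ℕ.* Y ℕ.≤ suc i → ℕ→ℚ 2 * expTerm (ℕ→ℚ Y) (suc i) ≤ expTerm (ℕ→ℚ Y) i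
  2*expTerm-suc≤expTerm Y i 2Y≤1+i =
    ≤-by-ℕ-multiples {f = suc i !} lhs rhs (ℕ.>-nonZero⁻¹ (suc i !) {{suc i ℕ.!≢0}}) (begin
      2 ℕ.* (Y ℕ.* Y ^ i)        ≡⟨ swap Y (Y ^ i) ⟩
      Y ^ i ℕ.* (2 ℕ.* Y)        ≤⟨ ℕ.*-monoʳ-≤ (Y ^ i) 2Y≤1+i ⟩
      Y ^ i ℕ.* suc i            ∎)
    where
    open ℕ.≤-Reasoning
    swap : ∀ y z → 2 ℕ.* (y ℕ.* z) ≡ z ℕ.* (2 ℕ.* y)
    swap = solve-∀
    lhs : ℕ→ℚ 2 * expTerm (ℕ→ℚ Y) (suc i) * ℕ→ℚ (suc i !) ≡ ℕ→ℚ (2 ℕ.* Y ^ suc i)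
    lhs = *-assoc (ℕ→ℚ 2) (expTerm (ℕ→ℚ Y) (suc i)) (ℕ→ℚ (suc i !))
          ⟨ trans ⟩ cong (ℕ→ℚ 2 *_) (expTerm-*-! Y (suc i)) ⟨ trans ⟩ sym (ℕ→ℚ-* 2 (Y ^ suc i))
    T = expTerm (ℕ→ℚ Y) i
    rhs : T * ℕ→ℚ (suc i !) ≡ ℕ→ℚ (Y ^ i ℕ.* suc i)
    rhs = ≡.begin
      T * ℕ→ℚ (suc i ℕ.* i !)            ≡.≡⟨ cong (T *_) (cong ℕ→ℚ (ℕ.*-comm (suc i) (i !)) ⟨ trans ⟩ ℕ→ℚ-* (i !) (suc i)) ⟩
      T * (ℕ→ℚ (i !) * ℕ→ℚ (suc i))      ≡.≡⟨ *-assoc T (ℕ→ℚ (i !)) (ℕ→ℚ (suc i)) ⟨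
      T * ℕ→ℚ (i !) * ℕ→ℚ (suc i)        ≡.≡⟨ cong (_* ℕ→ℚ (suc i)) (expTerm-*-! Y i) ⟩
      ℕ→ℚ (Y ^ i) * ℕ→ℚ (suc i)          ≡.≡⟨ ℕ→ℚ-* (Y ^ i) (suc i) ⟨
      ℕ→ℚ (Y ^ i ℕ.* suc i)              ≡.∎
      where module ≡ = ≡-Reasoning

  exp-bound : ℕ → ℕ
  exp-bound Y = suc (suc (2 ℕ.* Y)) ℕ.* 4 ^ Y

  expPartial≤[1+k]*4^Y : ∀ Y k → expPartial (ℕ→ℚ Y) k ≤ ℕ→ℚ (suc k ℕ.* 4 ^ Y)
  expPartial≤[1+k]*4^Y Y zero    = ℕ→ℚ-mono-≤ (ℕ.≤-trans (ℕ.m^n>0 4 Y) (ℕ.≤-reflexive (sym (ℕ.+-identityʳ (4 ^ Y)))))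
  expPartial≤[1+k]*4^Y Y (suc k) =
    subst (expPartial (ℕ→ℚ Y) (suc k) ≤_)
          (+-comm (ℕ→ℚ (suc k ℕ.* 4 ^ Y)) (ℕ→ℚ (4 ^ Y)) ⟨ trans ⟩ sym (ℕ→ℚ-+ (4 ^ Y) (suc k ℕ.* 4 ^ Y)))
          (+-mono-≤ (expPartial≤[1+k]*4^Y Y k) (expTerm≤4^Y Y (suc k)))

  -- From index 2Y on the terms at least halve, so the current term bounds the rest of the series.
  expPartial+expTerm≤exp-bound : ∀ Y j →
    expPartial (ℕ→ℚ Y) (2 ℕ.* Y ℕ.+ j) + expTerm (ℕ→ℚ Y) (2 ℕ.* Y ℕ.+ j) ≤ ℕ→ℚ (exp-bound Y)
  expPartial+expTerm≤exp-bound Y zero =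
    subst₂ (λ i b → expPartial (ℕ→ℚ Y) i + expTerm (ℕ→ℚ Y) i ≤ b) (sym (ℕ.+-identityʳ (2 ℕ.* Y)))
      (sym (ℕ→ℚ-+ (suc (2 ℕ.* Y) ℕ.* 4 ^ Y) (4 ^ Y))
         ⟨ trans ⟩ cong ℕ→ℚ (ℕ.+-comm (suc (2 ℕ.* Y) ℕ.* 4 ^ Y) (4 ^ Y)))
      (+-mono-≤ (expPartial≤[1+k]*4^Y Y (2 ℕ.* Y)) (expTerm≤4^Y Y (2 ℕ.* Y)))
  expPartial+expTerm≤exp-bound Y (suc j) =
    subst (λ i → expPartial (ℕ→ℚ Y) i + expTerm (ℕ→ℚ Y) i ≤ ℕ→ℚ (exp-bound Y)) (sym (ℕ.+-suc (2 ℕ.* Y) j))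
      (≤-trans step (expPartial+expTerm≤exp-bound Y j))
    where
    i = 2 ℕ.* Y ℕ.+ j
    P = expPartial (ℕ→ℚ Y) i
    T = expTerm (ℕ→ℚ Y) i
    T′ = expTerm (ℕ→ℚ Y) (suc i)
    2T′≡T′+T′ : ℕ→ℚ 2 * T′ ≡ T′ + T′
    2T′≡T′+T′ = cong (_* T′) (ℕ→ℚ-suc 1) ⟨ trans ⟩ *-distribʳ-+ T′ 1ℚ (ℕ→ℚ 1)
                ⟨ trans ⟩ cong₂ _+_ (*-identityˡ T′) (*-identityˡ T′)
    T′+T′≤T : T′ + T′ ≤ T
    T′+T′≤T = subst (_≤ T) 2T′≡T′+T′ (2*expTerm-suc≤expTerm Y i (ℕ.≤-trans (ℕ.m≤m+n (2 ℕ.* Y) j) (ℕ.n≤1+n _)))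
    step : P + T′ + T′ ≤ P + T
    step = subst (_≤ P + T) (sym (+-assoc P T′ T′)) (+-monoʳ-≤ P T′+T′≤T)

  expPartial≤exp-bound : ∀ Y k → expPartial (ℕ→ℚ Y) k ≤ ℕ→ℚ (exp-bound Y)
  expPartial≤exp-bound Y k with k ℕ.≤? 2 ℕ.* Y
  ... | yes k≤2Y =
    ≤-trans (expPartial≤[1+k]*4^Y Y k) (ℕ→ℚ-mono-≤ (ℕ.*-monoˡ-≤ (4 ^ Y) (ℕ.s≤s (ℕ.m≤n⇒m≤1+n k≤2Y))))
  ... | no  k≰2Y = subst (λ i → expPartial (ℕ→ℚ Y) i ≤ ℕ→ℚ (exp-bound Y)) 2Y+j≡k
                    (≤-trans (p≤p+q _ (expTerm-nonneg (2 ℕ.* Y ℕ.+ j) (0≤ℕ→ℚ Y))) (expPartial+expTerm≤exp-bound Y j))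
    where
    j = k ℕ.∸ 2 ℕ.* Y
    2Y+j≡k : 2 ℕ.* Y ℕ.+ j ≡ k
    2Y+j≡k = ℕ.m+[n∸m]≡n (ℕ.<⇒≤ (ℕ.≰⇒> k≰2Y))

  x²≤ln : ∀ {x M} X → 0ℚ ≤ x → x ≤ ℕ→ℚ X → exp-bound (X ℕ.* X) ℕ.≤ M → LeLn (x * x) M
  x²≤ln {x} X 0≤x x≤X bound k =
    ≤-trans (expPartial-mono k (*-nonneg 0≤x 0≤x) x²≤X²)
            (≤-trans (expPartial≤exp-bound (X ℕ.* X) k) (ℕ→ℚ-mono-≤ bound))
    where
    x²≤X² : x * x ≤ ℕ→ℚ (X ℕ.* X)
    x²≤X² = subst (x * x ≤_) (sym (ℕ→ℚ-* X X)) (*-mono-≤-nonneg 0≤x 0≤x x≤X x≤X)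


module RowGoodness where

  open import Data.Nat as ℕ using (ℕ; zero; suc; _^_)
  import Data.Nat.Properties as ℕ
  import Data.Integer as ℤ
  import Data.Integer.Properties as ℤ
  open import Data.Rational
  open import Data.Rational.Properties
  import Data.Rational.Unnormalised as ℚᵘ
  import Data.Rational.Unnormalised.Properties as ℚᵘ
  open import Data.Product using (∃-syntax; _×_; _,_)
  open import Data.Sum using (inj₁; inj₂)
  open import Relation.Binary.PropositionalEquality
  open import Relation.Nullary using (yes; no; contradiction)
  open import Function using (_⟨_⟩_)
  import Data.Rational.Solver as Solver
  open import Defs using (ℕ→ℚ; GoodRow)
  open NatCast
  open import Data.Nat.Coprimality using (1-coprimeTo) renaming (sym to coprime-sym)
  open ExpSeries

  0≤q-p : ∀ {p q} → p ≤ q → 0ℚ ≤ q - p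
  0≤q-p {p} {q} p≤q = subst (_≤ q - p) (+-inverseʳ p) (+-monoˡ-≤ (- p) p≤q)

  0<q-p : ∀ {p q} → p < q → 0ℚ < q - p
  0<q-p {p} {q} p<q = subst (_< q - p) (+-inverseʳ p) (+-monoˡ-< (- p) p<q)

  ≤-by-slack : ∀ {x y} d → x + d ≡ y → 0ℚ ≤ d → x ≤ y
  ≤-by-slack {x} d x+d≡y 0≤d = subst (x ≤_) x+d≡y (p≤p+q x 0≤d)

  deficit≤ : ∀ η t s w A n X → suc s ℕ.* t ≡ 2 ℕ.* n → ℕ→ℚ A < (½ + η) * ℕ→ℚ n →
    2 ℕ.* n ℕ.≤ 2 ℕ.* A ℕ.+ w ℕ.* t ℕ.+ 2 ℕ.* suc s ℕ.* X →
    ((½ - η) * ℕ→ℚ (suc s) - ℕ→ℚ w) * ℕ→ℚ t * (ℤ.+ 1 / (2 ℕ.* suc s)) ≤ ℕ→ℚ X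
  deficit≤ η t s w A n X st≡2n weak 2n≤ =
    ≤-trans (*-monoʳ-≤-nonNeg c {{nonNegative (0≤1/n (2 ℕ.* suc s))}} L≤Z) (≤-reflexive Z*c≡X)
    where
    open Solver.+-*-Solver
    S = ℕ→ℚ (suc s)
    Z = ℕ→ℚ (2 ℕ.* suc s ℕ.* X)
    c = ℤ.+ 1 / (2 ℕ.* suc s)
    L = ((½ - η) * S - ℕ→ℚ w) * ℕ→ℚ t
    δ = ℕ→ℚ 2 * ((½ + η) * ℕ→ℚ n - ℕ→ℚ A)
    ε = (ℕ→ℚ 2 * ℕ→ℚ A + ℕ→ℚ w * ℕ→ℚ t + Z) - ℕ→ℚ 2 * ℕ→ℚ n
    0≤δ : 0ℚ ≤ δ
    0≤δ = *-nonneg (0≤ℕ→ℚ 2) (0≤q-p (<⇒≤ weak))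
    0≤ε : 0ℚ ≤ ε
    0≤ε = 0≤q-p (subst₂ _≤_ (ℕ→ℚ-* 2 n)
            (ℕ→ℚ-+ (2 ℕ.* A ℕ.+ w ℕ.* t) _ ⟨ trans ⟩
             cong (_+ Z) (ℕ→ℚ-+ (2 ℕ.* A) (w ℕ.* t) ⟨ trans ⟩ cong₂ _+_ (ℕ→ℚ-* 2 A) (ℕ→ℚ-* w t)))
            (ℕ→ℚ-mono-≤ 2n≤))
    St≡2n : S * ℕ→ℚ t ≡ ℕ→ℚ 2 * ℕ→ℚ n
    St≡2n = sym (ℕ→ℚ-* (suc s) t) ⟨ trans ⟩ cong ℕ→ℚ st≡2n ⟨ trans ⟩ ℕ→ℚ-* 2 n
    expand : ∀ r S w t → (r * S - w) * t ≡ r * (S * t) - w * t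
    expand = solve 4 (λ r S w t → (r :* S :- w) :* t := r :* (S :* t) :- w :* t) refl
    balance : ∀ η two n A w t Z →
      (½ - η) * (two * n) - w * t + (two * ((½ + η) * n - A) + ((two * A + w * t + Z) - two * n)) ≡ Z
    balance = solve 7 (λ η two n A w t Z →
      (con ½ :- η) :* (two :* n) :- w :* t :+ (two :* ((con ½ :+ η) :* n :- A) :+ ((two :* A :+ w :* t :+ Z) :- two :* n))
        := Z) refl
    L+δ+ε≡Z : L + (δ + ε) ≡ Z
    L+δ+ε≡Z = cong (_+ (δ + ε)) (expand (½ - η) S (ℕ→ℚ w) (ℕ→ℚ t)
                                  ⟨ trans ⟩ cong (λ x → (½ - η) * x - ℕ→ℚ w * ℕ→ℚ t) St≡2n)
              ⟨ trans ⟩ balance η (ℕ→ℚ 2) (ℕ→ℚ n) (ℕ→ℚ A) (ℕ→ℚ w) (ℕ→ℚ t) Z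
    L≤Z : L ≤ Z
    L≤Z = ≤-by-slack (δ + ε) L+δ+ε≡Z (≤-trans 0≤δ (p≤p+q δ 0≤ε))
    rotate : ∀ a b c → a * b * c ≡ b * (c * a)
    rotate = solve 3 (λ a b c → a :* b :* c := b :* (c :* a)) refl
    Z*c≡X : Z * c ≡ ℕ→ℚ X
    Z*c≡X = begin
      ℕ→ℚ (2 ℕ.* suc s ℕ.* X) * c          ≡⟨ cong (_* c) (ℕ→ℚ-* (2 ℕ.* suc s) X) ⟩
      ℕ→ℚ (2 ℕ.* suc s) * ℕ→ℚ X * c        ≡⟨ rotate (ℕ→ℚ (2 ℕ.* suc s)) (ℕ→ℚ X) c ⟩
      ℕ→ℚ X * (c * ℕ→ℚ (2 ℕ.* suc s))      ≡⟨ cong (ℕ→ℚ X *_) (1/n*n≡1 (2 ℕ.* suc s)) ⟩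
      ℕ→ℚ X * 1ℚ                           ≡⟨ *-identityʳ (ℕ→ℚ X) ⟩
      ℕ→ℚ X                                ∎
      where open ≡-Reasoning

  good-row : ∀ η t S w A n X → 0 ℕ.< S → S ℕ.* t ≡ 2 ℕ.* n → ℕ→ℚ A < (½ + η) * ℕ→ℚ n →
    2 ℕ.* n ℕ.≤ 2 ℕ.* A ℕ.+ w ℕ.* t ℕ.+ 2 ℕ.* S ℕ.* X → exp-bound (X ℕ.* X) ℕ.≤ t ^ 3 →
    GoodRow η t S w
  good-row η t (suc s) w A n X _ st≡2n weak 2n≤ bound with deficit ≤? 0ℚ
    where deficit = ((½ - η) * ℕ→ℚ (suc s) - ℕ→ℚ w) * ℕ→ℚ t * (ℤ.+ 1 / (2 ℕ.* suc s))
  ... | yes deficit≤0 = inj₁ deficit≤0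
  ... | no  deficit≰0 = inj₂ (0≤deficit , x²≤ln X 0≤deficit (deficit≤ η t s w A n X st≡2n weak 2n≤) bound)
    where 0≤deficit = <⇒≤ (≰⇒> deficit≰0)

  -- Z ≤ (½ - η) n < n - A.
  weak-slack : ∀ η A n Z Dd → 0ℚ ≤ ½ - η → ℕ→ℚ A < (½ + η) * ℕ→ℚ n →
    1ℚ ≤ (½ - η) * ℕ→ℚ Dd → Dd ℕ.* Z ℕ.≤ n → Z ℕ.+ A ℕ.< n
  weak-slack η A n Z Dd 0≤ρ weak 1≤ρDd DdZ≤n with Z ℕ.+ A ℕ.<? n
  ... | yes Z+A<n = Z+A<n
  ... | no  Z+A≮n = contradiction (≤-<-trans n≤Z+A Z+A<n) (<-irrefl refl)
    where
    open Solver.+-*-Solver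
    ρ = ½ - η
    n≤Z+A : ℕ→ℚ n ≤ ℕ→ℚ Z + ℕ→ℚ A
    n≤Z+A = subst (ℕ→ℚ n ≤_) (ℕ→ℚ-+ Z A) (ℕ→ℚ-mono-≤ (ℕ.≮⇒≥ Z+A≮n))
    Z≤ρn : ℕ→ℚ Z ≤ ρ * ℕ→ℚ n
    Z≤ρn = begin
      ℕ→ℚ Z                       ≡⟨ *-identityˡ (ℕ→ℚ Z) ⟨
      1ℚ * ℕ→ℚ Z                  ≤⟨ *-monoʳ-≤-nonNeg (ℕ→ℚ Z) {{nonNegative (0≤ℕ→ℚ Z)}} 1≤ρDd ⟩
      ρ * ℕ→ℚ Dd * ℕ→ℚ Z          ≡⟨ *-assoc ρ (ℕ→ℚ Dd) (ℕ→ℚ Z) ⟩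
      ρ * (ℕ→ℚ Dd * ℕ→ℚ Z)        ≡⟨ cong (ρ *_) (ℕ→ℚ-* Dd Z) ⟨
      ρ * ℕ→ℚ (Dd ℕ.* Z)          ≤⟨ *-monoˡ-≤-nonNeg ρ {{nonNegative 0≤ρ}} (ℕ→ℚ-mono-≤ DdZ≤n) ⟩
      ρ * ℕ→ℚ n                   ∎
      where open ≤-Reasoning
    halves : ∀ η n → (½ - η) * n + (½ + η) * n ≡ n
    halves = solve 2 (λ η n → (con ½ :- η) :* n :+ (con ½ :+ η) :* n := n) refl
    Z+A<n : ℕ→ℚ Z + ℕ→ℚ A < ℕ→ℚ n
    Z+A<n = ≤-<-trans (+-monoˡ-≤ (ℕ→ℚ A) Z≤ρn)
                      (subst (ρ * ℕ→ℚ n + ℕ→ℚ A <_) (halves η (ℕ→ℚ n)) (+-monoʳ-< (ρ * ℕ→ℚ n) weak))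

  ∃-multiple≥1 : ∀ ρ → 0ℚ < ρ → ∃[ D ] (0 ℕ.< D × 1ℚ ≤ ρ * ℕ→ℚ D)
  ∃-multiple≥1 ρ@(mkℚ ℤ.+[1+ k ] d-1 _) _ = D , ℕ.z<s , 1≤ρD
    where
    D = suc d-1
    1*D≤[1+k]*D : ℤ.+ 1 ℤ.* (ℤ.+ D ℤ.* ℤ.+ 1) ℤ.≤ (ℤ.+[1+ k ] ℤ.* ℤ.+ D) ℤ.* ℤ.+ 1
    1*D≤[1+k]*D = subst₂ ℤ._≤_ (sym (ℤ.*-identityˡ (ℤ.+ D ℤ.* ℤ.+ 1) ⟨ trans ⟩ ℤ.*-identityʳ (ℤ.+ D)))
                              (ℤ.pos-* (suc k) D ⟨ trans ⟩ sym (ℤ.*-identityʳ (ℤ.+[1+ k ] ℤ.* ℤ.+ D)))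
                              (ℤ.+≤+ (ℕ.m≤n*m D (suc k)))
    1≤ρD : 1ℚ ≤ ρ * ℕ→ℚ D
    1≤ρD rewrite ℕ→ℚ≡mkℚ D =
      toℚᵘ-cancel-≤ (ℚᵘ.≤-respʳ-≃ (ℚᵘ.≃-sym (toℚᵘ-homo-* ρ (mkℚ (ℤ.+ D) 0 (coprime-sym (1-coprimeTo D)))))
                                  (ℚᵘ.*≤* 1*D≤[1+k]*D))
  ∃-multiple≥1 (mkℚ (ℤ.+ zero) _ _) (*<* (ℤ.+<+ ()))
  ∃-multiple≥1 (mkℚ ℤ.-[1+ _ ] _ _) (*<* ())


module Counting where

  open import Data.Bool using (Bool; true; false; if_then_else_; _∧_; not)
  open import Data.Bool.Properties using (∧-identityʳ; T-≡; ¬-not)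
  open import Function.Bundles using (Equivalence)
  open import Data.Nat
  open import Data.Nat.Properties
  open import Data.Fin using (Fin; zero; suc; toℕ)
  import Data.Fin.Properties as Fin
  open import Data.Fin.Subset using (Subset; ∣_∣)
  open import Data.Vec using (_∷_; []; tabulate)
  open import Data.Vec.Properties using (lookup∘tabulate)
  open import Relation.Binary.PropositionalEquality
  open import Relation.Nullary using (contradiction)
  open import Defs using (sumFin; countFin; mem; isFree; outDeg)
  open FiniteSums

  ∣p∣≡countFin-mem : ∀ {n} (X : Subset n) → ∣ X ∣ ≡ countFin (mem X)
  ∣p∣≡countFin-mem []          = refl
  ∣p∣≡countFin-mem (true  ∷ X) = cong suc (∣p∣≡countFin-mem X)
  ∣p∣≡countFin-mem (false ∷ X) = ∣p∣≡countFin-mem X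

  countFin-none : ∀ {n} (f : Fin n → Bool) → (∀ i → f i ≢ true) → countFin f ≡ 0
  countFin-none {zero}  f none = refl
  countFin-none {suc n} f none with f zero in f0
  ... | true  = contradiction f0 (none zero)
  ... | false = countFin-none (λ i → f (suc i)) (λ i → none (suc i))

  countFin-unique≤1 : ∀ {n} (f : Fin n → Bool) → (∀ i j → f i ≡ true → f j ≡ true → i ≡ j) → countFin f ≤ 1
  countFin-unique≤1 {zero}  f unique = z≤n
  countFin-unique≤1 {suc n} f unique with f zero in f0
  ... | true  = ≤-reflexive (cong suc (countFin-none (λ i → f (suc i)) (λ i fi → Fin.0≢1+n (unique zero (suc i) f0 fi))))
  ... | false = countFin-unique≤1 (λ i → f (suc i)) (λ i j fi fj → Fin.suc-injective (unique (suc i) (suc j) fi fj))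

  free+mem+in-arcs≥1 : ∀ {n} (D : Fin n → Fin n → Bool) (X : Subset n) v →
    1 ≤ indicator (isFree D X v) + indicator (mem X v) + countFin (λ u → mem X u ∧ not (mem X v) ∧ D u v)
  free+mem+in-arcs≥1 D X v with mem X v
  ... | true  = s≤s z≤n
  ... | false with countFin (λ u → mem X u ∧ D u v) ≡ᵇ 0 in no-arc
  ...   | true  = s≤s z≤n
  ...   | false = ≤-trans (≢ᵇ0⇒>0 (countFin (λ u → mem X u ∧ D u v)) no-arc) (m≤n+m _ _)
    where
    ≢ᵇ0⇒>0 : ∀ k → (k ≡ᵇ 0) ≡ false → 0 < k
    ≢ᵇ0⇒>0 (suc k) _ = z<s

  free+size+outDeg≥n : ∀ {n} (D : Fin n → Fin n → Bool) (X : Subset n) →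
    n ≤ countFin (isFree D X) + countFin (mem X) + outDeg D X
  free+size+outDeg≥n {n} D X = begin
    n                                                          ≡⟨ trans (sumFin-const n 1) (*-identityʳ n) ⟨
    sumFin {n} (λ _ → 1)                                       ≤⟨ sumFin-mono-≤ (free+mem+in-arcs≥1 D X) ⟩
    sumFin (λ v → free v + inX v + in-arcs v)                  ≡⟨ sumFin-distrib-+ (λ v → free v + inX v) in-arcs ⟩
    sumFin (λ v → free v + inX v) + sumFin in-arcs             ≡⟨ cong₂ _+_ (sumFin-distrib-+ free inX)
                                                                    (sym (sumFin-comm (λ u v → indicator (mem X u ∧ not (mem X v) ∧ D u v)))) ⟩
    countFin (isFree D X) + countFin (mem X) + outDeg D X      ∎
    where
    open ≤-Reasoning
    free inX in-arcs : Fin _ → ℕ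
    free v = indicator (isFree D X v)
    inX v = indicator (mem X v)
    in-arcs v = countFin (λ u → mem X u ∧ not (mem X v) ∧ D u v)

  sum-sizes≤n : ∀ {m n} (W : Fin m → Subset n) → (∀ i j v → mem (W i) v ≡ true → mem (W j) v ≡ true → i ≡ j) →
    sumFin (λ i → countFin (mem (W i))) ≤ n
  sum-sizes≤n {m} {n} W disjoint = begin
    sumFin (λ i → countFin (mem (W i)))            ≡⟨ sumFin-comm (λ i v → indicator (mem (W i) v)) ⟩
    sumFin (λ v → countFin (λ i → mem (W i) v))    ≤⟨ sumFin-mono-≤ (λ v → countFin-unique≤1 _ (λ i j → disjoint i j v)) ⟩
    sumFin {n} (λ _ → 1)                           ≡⟨ trans (sumFin-const n 1) (*-identityʳ n) ⟩
    n                                              ∎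
    where open ≤-Reasoning

  -- chosen q s c k holds iff k = b * q + c b for some b < s: blocks of length q, with c b
  -- the position chosen in block b.
  chosen : ℕ → ℕ → (ℕ → ℕ) → ℕ → Bool
  chosen q zero    c k = false
  chosen q (suc s) c k = if k <ᵇ q then k ≡ᵇ c 0 else chosen q s (λ b → c (suc b)) (k ∸ q)

  <ᵇ-true : ∀ {k q} → k < q → (k <ᵇ q) ≡ true
  <ᵇ-true k<q = Equivalence.to T-≡ (<⇒<ᵇ k<q)

  <ᵇ-false : ∀ {k q} → q ≤ k → (k <ᵇ q) ≡ false
  <ᵇ-false {k} {q} q≤k = ¬-not (λ k<ᵇq → ≤⇒≯ q≤k (<ᵇ⇒< k q (Equivalence.from T-≡ k<ᵇq)))

  sum<-≡ᵇ : ∀ q c₀ (F : ℕ → Bool) → c₀ < q → sum< q (λ k → indicator ((k ≡ᵇ c₀) ∧ F k)) ≡ indicator (F c₀)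
  sum<-≡ᵇ (suc q) zero     F _         = trans (cong (indicator (F 0) +_) (sum<-zero q (λ _ _ → refl))) (+-identityʳ _)
  sum<-≡ᵇ (suc q) (suc c₀) F (s<s c₀<q) = sum<-≡ᵇ q c₀ (λ k → F (suc k)) c₀<q

  chosen-≥ : ∀ q s c k → s * q ≤ k → chosen q s c k ≡ false
  chosen-≥ q zero    c k _      = refl
  chosen-≥ q (suc s) c k sq≤k rewrite <ᵇ-false (≤-trans (m≤m+n q (s * q)) sq≤k) =
    chosen-≥ q s (λ b → c (suc b)) (k ∸ q) (subst (_≤ k ∸ q) (m+n∸m≡n q (s * q)) (∸-monoˡ-≤ q sq≤k))

  sum<-chosen : ∀ q s c (F : ℕ → Bool) → (∀ b → b < s → c b < q) →
    sum< (s * q) (λ k → indicator (chosen q s c k ∧ F k)) ≡ sum< s (λ b → indicator (F (b * q + c b)))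
  sum<-chosen q zero    c F c<q = refl
  sum<-chosen q (suc s) c F c<q = begin
    sum< (q + s * q) (λ k → indicator (chosen q (suc s) c k ∧ F k))
      ≡⟨ sum<-splitAt q (s * q) _ ⟩
    sum< q (λ k → indicator (chosen q (suc s) c k ∧ F k)) + sum< (s * q) (λ k → indicator (chosen q (suc s) c (q + k) ∧ F (q + k)))
      ≡⟨ cong₂ _+_ first-block later-blocks ⟩
    indicator (F (c 0)) + sum< s (λ b → indicator (F (q + b * q + c (suc b)))) ∎
    where
    open ≡-Reasoning
    c′ : ℕ → ℕ
    c′ b = c (suc b)
    first-block : sum< q (λ k → indicator (chosen q (suc s) c k ∧ F k)) ≡ indicator (F (c 0))
    first-block = trans (sum<-cong q (λ k k<q → cong (λ x → indicator ((if x then k ≡ᵇ c 0 else chosen q s c′ (k ∸ q)) ∧ F k)) (<ᵇ-true k<q)))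
                        (sum<-≡ᵇ q (c 0) F (c<q 0 z<s))
    later-blocks : sum< (s * q) (λ k → indicator (chosen q (suc s) c (q + k) ∧ F (q + k)))
                 ≡ sum< s (λ b → indicator (F (q + b * q + c′ b)))
    later-blocks = begin
      sum< (s * q) (λ k → indicator (chosen q (suc s) c (q + k) ∧ F (q + k)))
        ≡⟨ sum<-cong (s * q) (λ k _ → cong (λ x → indicator ((if x then q + k ≡ᵇ c 0 else chosen q s c′ (q + k ∸ q)) ∧ F (q + k)))
                                            (<ᵇ-false (m≤m+n q k))) ⟩
      sum< (s * q) (λ k → indicator (chosen q s c′ (q + k ∸ q) ∧ F (q + k)))
        ≡⟨ sum<-cong (s * q) (λ k _ → cong (λ x → indicator (chosen q s c′ x ∧ F (q + k))) (m+n∸m≡n q k)) ⟩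
      sum< (s * q) (λ k → indicator (chosen q s c′ k ∧ F (q + k)))
        ≡⟨ sum<-chosen q s c′ (λ k → F (q + k)) (λ b b<s → c<q (suc b) (s<s b<s)) ⟩
      sum< s (λ b → indicator (F (q + (b * q + c′ b))))
        ≡⟨ sum<-cong s (λ b _ → cong (λ x → indicator (F x)) (+-assoc q (b * q) (c′ b))) ⟨
      sum< s (λ b → indicator (F (q + b * q + c′ b))) ∎

  sum<-chosen-≤ : ∀ {n} q s c (F : ℕ → Bool) → s * q ≤ n → (∀ b → b < s → c b < q) →
    sum< n (λ k → indicator (chosen q s c k ∧ F k)) ≡ sum< s (λ b → indicator (F (b * q + c b)))
  sum<-chosen-≤ {n} q s c F sq≤n c<q = begin
    sum< n (λ k → indicator (chosen q s c k ∧ F k))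
      ≡⟨ cong (λ m → sum< m (λ k → indicator (chosen q s c k ∧ F k))) (m+[n∸m]≡n sq≤n) ⟨
    sum< (s * q + (n ∸ s * q)) (λ k → indicator (chosen q s c k ∧ F k))
      ≡⟨ sum<-splitAt (s * q) (n ∸ s * q) _ ⟩
    sum< (s * q) (λ k → indicator (chosen q s c k ∧ F k)) + sum< (n ∸ s * q) (λ k → indicator (chosen q s c (s * q + k) ∧ F (s * q + k)))
      ≡⟨ cong₂ _+_ (sum<-chosen q s c F c<q)
                   (sum<-zero (n ∸ s * q) (λ k _ → cong (λ x → indicator (x ∧ F (s * q + k))) (chosen-≥ q s c _ (m≤m+n (s * q) k)))) ⟩
    sum< s (λ b → indicator (F (b * q + c b))) + 0
      ≡⟨ +-identityʳ _ ⟩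
    sum< s (λ b → indicator (F (b * q + c b))) ∎
    where open ≡-Reasoning

  selection : ∀ n → ℕ → ℕ → (ℕ → ℕ) → Subset n
  selection n q s c = tabulate (λ v → chosen q s c (toℕ v))

  module _ {n q s : ℕ} {c : ℕ → ℕ} (sq≤n : s * q ≤ n) (c<q : ∀ b → b < s → c b < q) where

    countFin-selection-∧ : ∀ (F : Fin n → Bool) →
      countFin (λ v → mem (selection n q s c) v ∧ F v) ≡ sum< s (λ b → indicator (liftℕ F (b * q + c b)))
    countFin-selection-∧ F = begin
      countFin (λ v → mem (selection n q s c) v ∧ F v)
        ≡⟨ sumFin-cong {n} (λ v → cong₂ (λ x y → indicator (x ∧ y)) (lookup∘tabulate (λ w → chosen q s c (toℕ w)) v) (sym (liftℕ-toℕ F v))) ⟩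
      countFin {n} (λ v → chosen q s c (toℕ v) ∧ liftℕ F (toℕ v))
        ≡⟨ countFin-toℕ {n} (λ k → chosen q s c k ∧ liftℕ F k) ⟩
      sum< n (λ k → indicator (chosen q s c k ∧ liftℕ F k))
        ≡⟨ sum<-chosen-≤ q s c (liftℕ F) sq≤n c<q ⟩
      sum< s (λ b → indicator (liftℕ F (b * q + c b))) ∎
      where open ≡-Reasoning

    ∣selection∣ : ∣ selection n q s c ∣ ≡ s
    ∣selection∣ = begin
      ∣ selection n q s c ∣                                      ≡⟨ ∣p∣≡countFin-mem (selection n q s c) ⟩
      countFin (λ v → mem (selection n q s c) v)                 ≡⟨ sumFin-cong {n} (λ v → cong indicator (lookup∘tabulate (λ w → chosen q s c (toℕ w)) v)) ⟩
      countFin {n} (λ v → chosen q s c (toℕ v))                  ≡⟨ countFin-toℕ {n} (chosen q s c) ⟩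
      sum< n (λ k → indicator (chosen q s c k))                  ≡⟨ sum<-cong n (λ k _ → cong indicator (∧-identityʳ _)) ⟨
      sum< n (λ k → indicator (chosen q s c k ∧ true))           ≡⟨ sum<-chosen-≤ q s c (λ _ → true) sq≤n c<q ⟩
      sum< s (λ _ → 1)                                           ≡⟨ trans (sum<-const s 1) (*-identityʳ s) ⟩
      s                                                          ∎
      where open ≡-Reasoning


module Parameters where

  open import Data.Nat
  open import Data.Nat.Properties
  open import Data.Nat.DivMod using (_/_; _%_; m/n*n≤m; m≡m%n+[m/n]*n; m%n<n; m≥n⇒m/n>0)
  open import Data.Product using (∃-syntax; _×_; _,_)
  open import Relation.Binary.PropositionalEquality
  open import Function using (_⟨_⟩_)
  open import Relation.Nullary using (yes; no; contradiction)
  open import Data.Nat.Tactic.RingSolver using (solve-∀)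
  open ExpSeries using (exp-bound)
  open PowerBounds using (^-distribʳ-*; *-self-≤⇒≤)

  n<2^n : ∀ n → n < 2 ^ n
  n<2^n zero    = z<s
  n<2^n (suc n) = +-mono-≤ (m^n>0 2 n) (≤-trans (n<2^n n) (≤-reflexive (sym (+-identityʳ (2 ^ n)))))

  ∃-log-root : ∀ t → 0 < t → ∃[ r ] (2 ^ (r * r) ≤ t × t < 2 ^ (suc r * suc r))
  ∃-log-root t t>0 = search t (<-≤-trans (n<2^n t) (^-monoʳ-≤ 2 (m≤m*n t t {{>-nonZero t>0}})))
    where
    search : ∀ k → t < 2 ^ (k * k) → ∃[ r ] (2 ^ (r * r) ≤ t × t < 2 ^ (suc r * suc r))
    search zero    t<1 = contradiction t<1 (≤⇒≯ t>0)
    search (suc k) t<2^k² with t <? 2 ^ (k * k)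
    ... | yes t<   = search k t<
    ... | no  t≮   = k , ≮⇒≥ t≮ , t<2^k²

  k*k≤4^k : ∀ k → k * k ≤ 4 ^ k
  k*k≤4^k k = ≤-trans (*-mono-≤ (<⇒≤ (n<2^n k)) (<⇒≤ (n<2^n k))) (≤-reflexive (sym (^-distribʳ-* 2 2 k)))

  k*k*k≤2^[3k] : ∀ k → k * k * k ≤ 2 ^ (3 * k)
  k*k*k≤2^[3k] k = begin
    k * k * k                  ≤⟨ *-mono-≤ (*-mono-≤ (<⇒≤ (n<2^n k)) (<⇒≤ (n<2^n k))) (<⇒≤ (n<2^n k)) ⟩
    2 ^ k * 2 ^ k * 2 ^ k      ≡⟨ cong (_* 2 ^ k) (^-distribˡ-+-* 2 k k) ⟨
    2 ^ (k + k) * 2 ^ k        ≡⟨ ^-distribˡ-+-* 2 (k + k) k ⟨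
    2 ^ (k + k + k)            ≡⟨ cong (2 ^_) (triple k) ⟩
    2 ^ (3 * k)                ∎
    where
    open ≤-Reasoning
    triple : ∀ k → k + k + k ≡ 3 * k
    triple = solve-∀

  4^k≡2^[2k] : ∀ k → 4 ^ k ≡ 2 ^ (2 * k)
  4^k≡2^[2k] k = trans (cong (_^ k) (refl {x = 2 ^ 2})) (^-*-assoc 2 2 k)

  linear≤square : ∀ {r} a b c → 25 ≤ r → c ≤ 25 * b → a + b ≤ 25 → a * r + c ≤ r * r
  linear≤square {r} a b c 25≤r c≤25b a+b≤25 = begin
    a * r + c          ≤⟨ +-monoʳ-≤ (a * r) (≤-trans c≤25b (≤-trans (*-monoˡ-≤ b 25≤r) (≤-reflexive (*-comm r b)))) ⟩
    a * r + b * r      ≡⟨ *-distribʳ-+ r a b ⟨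
    (a + b) * r        ≤⟨ *-monoˡ-≤ r (≤-trans a+b≤25 25≤r) ⟩
    r * r              ∎
    where open ≤-Reasoning

  module Large-r {r} (25≤r : 25 ≤ r) where

    R X : ℕ
    R = suc r
    X = R + 4

    R³≤2^r² : R * R * R ≤ 2 ^ (r * r)
    R³≤2^r² = ≤-trans (k*k*k≤2^[3k] R) (^-monoʳ-≤ 2 3R≤r²)
      where
      expand : ∀ r → 3 * r + 3 ≡ 3 * suc r
      expand = solve-∀
      3R≤r² : 3 * R ≤ r * r
      3R≤r² = subst (_≤ r * r) (expand r) (linear≤square 3 1 3 25≤r (≤ᵇ⇒≤ 3 25 _) (≤ᵇ⇒≤ 4 25 _))

    X²≤2^r² : X * X ≤ 2 ^ (r * r)
    X²≤2^r² = ≤-trans (k*k≤4^k X) (subst (_≤ 2 ^ (r * r)) (sym (4^k≡2^[2k] X)) (^-monoʳ-≤ 2 2X≤r²))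
      where
      expand : ∀ r → 2 * r + 10 ≡ 2 * (suc r + 4)
      expand = solve-∀
      2X≤r² : 2 * X ≤ r * r
      2X≤r² = subst (_≤ r * r) (expand r) (linear≤square 2 1 10 25≤r (≤ᵇ⇒≤ 10 25 _) (≤ᵇ⇒≤ 3 25 _))

    exp-bound≤2^[3r²] : exp-bound (X * X) ≤ 2 ^ (3 * (r * r))
    exp-bound≤2^[3r²] = begin
      suc (suc (2 * (X * X))) * 4 ^ (X * X)   ≤⟨ *-monoˡ-≤ (4 ^ (X * X)) 2+2X²≤4^[1+X] ⟩
      4 ^ suc X * 4 ^ (X * X)                 ≡⟨ ^-distribˡ-+-* 4 (suc X) (X * X) ⟨
      4 ^ (suc X + X * X)                     ≡⟨ 4^k≡2^[2k] (suc X + X * X) ⟩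
      2 ^ (2 * (suc X + X * X))               ≤⟨ ^-monoʳ-≤ 2 exponent ⟩
      2 ^ (3 * (r * r))                       ∎
      where
      open ≤-Reasoning
      2+2X²≤4^[1+X] : suc (suc (2 * (X * X))) ≤ 4 ^ suc X
      2+2X²≤4^[1+X] = begin
        2 + 2 * (X * X)        ≤⟨ +-monoˡ-≤ (2 * (X * X)) (*-monoʳ-≤ 2 (*-mono-≤ {1} {X} {1} {X} (s≤s z≤n) (s≤s z≤n))) ⟩
        2 * (X * X) + 2 * (X * X) ≡⟨ twice (X * X) ⟩
        4 * (X * X)            ≤⟨ *-monoʳ-≤ 4 (k*k≤4^k X) ⟩
        4 * 4 ^ X              ∎
        where
        twice : ∀ y → 2 * y + 2 * y ≡ 4 * y
        twice = solve-∀
      expand : ∀ r → 2 * (suc (suc r + 4) + (suc r + 4) * (suc r + 4)) ≡ 2 * (r * r) + (22 * r + 62)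
      expand = solve-∀
      exponent : 2 * (suc X + X * X) ≤ 3 * (r * r)
      exponent = begin
        2 * (suc X + X * X)            ≡⟨ expand r ⟩
        2 * (r * r) + (22 * r + 62)    ≤⟨ +-monoʳ-≤ (2 * (r * r)) (linear≤square 22 3 62 25≤r (≤ᵇ⇒≤ 62 75 _) ≤-refl) ⟩
        2 * (r * r) + r * r            ≡⟨ +-comm (2 * (r * r)) (r * r) ⟩
        3 * (r * r)                    ∎

  -- For r < 25 we have X ≤ 29, so K₀ covers the finitely many small cases.
  opaque
    K₀ : ℕ
    K₀ = exp-bound (29 * 29)

    25³≤K₀ : 25 * 25 * 25 ≤ K₀
    25³≤K₀ = ≤ᵇ⇒≤ (25 * 25 * 25) (exp-bound (29 * 29)) _

    29²≤K₀ : 29 * 29 ≤ K₀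
    29²≤K₀ = ≤ᵇ⇒≤ (29 * 29) (exp-bound (29 * 29)) _

    exp-bound[29²]≤K₀ : exp-bound (29 * 29) ≤ K₀
    exp-bound[29²]≤K₀ = ≤-refl

  t≤t³ : ∀ t → t ≤ t ^ 3
  t≤t³ zero    = z≤n
  t≤t³ (suc t) = m≤m*n (suc t) (suc t * (suc t * 1))

  record Conditions (t Dd r : ℕ) : Set where
    field
      R³≤t         : suc r * suc r * suc r ≤ t
      X²≤t         : (suc r + 4) * (suc r + 4) ≤ t
      exp-bound≤t³ : exp-bound ((suc r + 4) * (suc r + 4)) ≤ t ^ 3
      2DdX≤t       : 2 * Dd * (suc r + 4) ≤ t

  2DX≤t : ∀ {t} D X → 4 * D * D ≤ t → X * X ≤ t → 2 * D * X ≤ t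
  2DX≤t {t} D X 4D²≤t X²≤t = *-self-≤⇒≤ (begin
    2 * D * X * (2 * D * X)      ≡⟨ square D X ⟩
    4 * D * D * (X * X)          ≤⟨ *-mono-≤ 4D²≤t X²≤t ⟩
    t * t                        ∎)
    where
    open ≤-Reasoning
    square : ∀ D X → 2 * D * X * (2 * D * X) ≡ 4 * D * D * (X * X)
    square = solve-∀

  conditions : ∀ t Dd r → K₀ + 4 * Dd * Dd ≤ t → 2 ^ (r * r) ≤ t → Conditions t Dd r
  conditions t Dd r t₀≤t 2^r²≤t with 25 ≤? r
  ... | yes 25≤r = record
    { R³≤t = ≤-trans R³≤2^r² 2^r²≤t
    ; X²≤t = ≤-trans X²≤2^r² 2^r²≤t
    ; exp-bound≤t³ = ≤-trans exp-bound≤2^[3r²]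
                       (subst (_≤ t ^ 3) (^-*-assoc 2 (r * r) 3 ⟨ trans ⟩ cong (2 ^_) (*-comm (r * r) 3)) (^-monoˡ-≤ 3 2^r²≤t))
    ; 2DdX≤t = 2DX≤t Dd (suc r + 4) (≤-trans (m≤n+m _ K₀) t₀≤t) (≤-trans X²≤2^r² 2^r²≤t)
    }
    where open Large-r 25≤r
  ... | no 25≰r = record
    { R³≤t = ≤-trans (*-mono-≤ (*-mono-≤ R≤25 R≤25) R≤25) (≤-trans 25³≤K₀ K₀≤t)
    ; X²≤t = X²≤t
    ; exp-bound≤t³ = ≤-trans (*-mono-≤ (s≤s (s≤s (*-monoʳ-≤ 2 X²≤29²))) (^-monoʳ-≤ 4 X²≤29²))
                             (≤-trans exp-bound[29²]≤K₀ (≤-trans K₀≤t (t≤t³ t)))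
    ; 2DdX≤t = 2DX≤t Dd (suc r + 4) (≤-trans (m≤n+m _ K₀) t₀≤t) X²≤t
    }
    where
    K₀≤t : K₀ ≤ t
    K₀≤t = ≤-trans (m≤m+n K₀ _) t₀≤t
    R≤25 : suc r ≤ 25
    R≤25 = ≰⇒> 25≰r
    X²≤29² : (suc r + 4) * (suc r + 4) ≤ 29 * 29
    X²≤29² = *-mono-≤ (+-monoˡ-≤ 4 R≤25) (+-monoˡ-≤ 4 R≤25)
    X²≤t : (suc r + 4) * (suc r + 4) ≤ t
    X²≤t = ≤-trans X²≤29² (≤-trans 29²≤K₀ K₀≤t)

  m<[1+m/n]*n : ∀ m n .{{_ : NonZero n}} → m < suc (m / n) * n
  m<[1+m/n]*n m n = begin-strict
    m                   ≡⟨ m≡m%n+[m/n]*n m n ⟩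
    m % n + m / n * n   <⟨ +-monoˡ-< (m / n * n) (m%n<n m n) ⟩
    n + m / n * n       ∎
    where open ≤-Reasoning

  t^2≡t*t : ∀ t → t ^ 2 ≡ t * t
  t^2≡t*t t = cong (t *_) (*-identityʳ t)

  t^3≡t*t*t : ∀ t → t ^ 3 ≡ t * t * t
  t^3≡t*t*t t = trans (cong (t *_) (t^2≡t*t t)) (sym (*-assoc t t t))

  -- The s = 2 t² blocks of q = ⌊t/2⌋ consecutive vertices cover all but at most t² of the
  -- n = t³ vertices. With R ≈ √(log₂ t) the union bound over the at most t < 2 ^ (R * R) rows
  -- costs a factor 2 ^ L, the estimator weighs hits with N = 2 ⌊t/R⌋, and a row may fall
  -- short of its expected number of hits by λ′ = (N + 1) (2 L), of order t R.
  module Scales {t Dd r : ℕ} (cond : Conditions t Dd r) (t<2^R² : t < 2 ^ (suc r * suc r)) where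
    open Conditions cond

    R X L n s : ℕ
    R = suc r
    X = R + 4
    L = R * R + 2
    n = t ^ 3
    s = 2 * t ^ 2

    d q N h λ′ : ℕ
    d = t / R
    q = t / 2
    N = d + d
    h = d * suc (suc N)
    λ′ = suc N * (L + L)

    t≥2 : 2 ≤ t
    t≥2 = ≤-trans (≤ᵇ⇒≤ 2 (4 * 4) _) (≤-trans (*-mono-≤ (m≤n+m 4 R) (m≤n+m 4 R)) X²≤t)

    R*R≤t : R * R ≤ t
    R*R≤t = ≤-trans (*-mono-≤ (m≤m+n R 4) (m≤m+n R 4)) X²≤t

    dR≤t : d * R ≤ t
    dR≤t = m/n*n≤m t R

    t<[1+d]R : t < suc d * R
    t<[1+d]R = m<[1+m/n]*n t R

    d≤t : d ≤ t
    d≤t = ≤-trans (m≤m*n d R) dR≤t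

    R*R≤d : R * R ≤ d
    R*R≤d = ≤-pred (*-cancelʳ-< R (R * R) (suc d) (≤-<-trans R³≤t t<[1+d]R))

    h>0 : 0 < h
    h>0 = *-mono-≤ {1} {d} {1} (≤-trans (≤-trans (s≤s z≤n) (m≤m*n R R)) R*R≤d) z<s

    N[2+N]≡2h : N * suc (suc N) ≡ 2 * h
    N[2+N]≡2h = double d
      where
      double : ∀ d → (d + d) * suc (suc (d + d)) ≡ 2 * (d * suc (suc (d + d)))
      double = solve-∀

    2q≤t : 2 * q ≤ t
    2q≤t = subst (_≤ t) (*-comm q 2) (m/n*n≤m t 2)

    t<2[1+q] : t < suc q * 2
    t<2[1+q] = m<[1+m/n]*n t 2

    q>0 : 0 < q
    q>0 = m≥n⇒m/n>0 t≥2

    sq≤n : s * q ≤ n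
    sq≤n = begin
      2 * t ^ 2 * q       ≡⟨ reorder (t ^ 2) q ⟩
      t ^ 2 * (2 * q)     ≤⟨ *-monoʳ-≤ (t ^ 2) 2q≤t ⟩
      t ^ 2 * t           ≡⟨ *-comm (t ^ 2) t ⟩
      t ^ 3               ∎
      where
      open ≤-Reasoning
      reorder : ∀ x q → 2 * x * q ≡ x * (2 * q)
      reorder = solve-∀

    n≤sq+t² : n ≤ s * q + t ^ 2
    n≤sq+t² = begin
      t ^ 3               ≡⟨ *-comm t (t ^ 2) ⟩
      t ^ 2 * t           ≤⟨ *-monoʳ-≤ (t ^ 2) (≤-pred (subst (t <_) (double q) t<2[1+q])) ⟩
      t ^ 2 * suc (2 * q) ≡⟨ expand (t ^ 2) q ⟩
      2 * t ^ 2 * q + t ^ 2 ∎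
      where
      open ≤-Reasoning
      double : ∀ q → suc q * 2 ≡ suc (suc (2 * q))
      double = solve-∀
      expand : ∀ x q → x * suc (2 * q) ≡ 2 * x * q + x
      expand = solve-∀

    λ′+4t≤4tX : λ′ + 4 * t ≤ 4 * t * X
    λ′+4t≤4tX = begin
      λ′ + 4 * t                                           ≡⟨ expand d R t ⟩
      4 * (d * R) * R + 8 * d + (2 * (R * R) + 4) + 4 * t  ≤⟨ +-monoˡ-≤ (4 * t) (+-mono-≤ (+-mono-≤ (*-monoˡ-≤ R (*-monoʳ-≤ 4 dR≤t))
                                                                (*-monoʳ-≤ 8 d≤t)) (+-mono-≤ (*-monoʳ-≤ 2 R*R≤t) (*-monoʳ-≤ 2 t≥2))) ⟩
      4 * t * R + 8 * t + (2 * t + 2 * t) + 4 * t          ≡⟨ collect t R ⟩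
      4 * t * X                                            ∎
      where
      open ≤-Reasoning
      expand : ∀ d R t → suc (d + d) * ((R * R + 2) + (R * R + 2)) + 4 * t ≡ 4 * (d * R) * R + 8 * d + (2 * (R * R) + 4) + 4 * t
      expand = solve-∀
      collect : ∀ t R → 4 * t * R + 8 * t + (2 * t + 2 * t) + 4 * t ≡ 4 * t * (R + 4)
      collect = solve-∀

    s≤hL : s ≤ h * L
    s≤hL = begin
      2 * t ^ 2                            ≡⟨ cong (2 *_) (t^2≡t*t t) ⟩
      2 * (t * t)                          ≤⟨ *-monoʳ-≤ 2 (*-mono-≤ (<⇒≤ t<[1+d]R) (<⇒≤ t<[1+d]R)) ⟩
      2 * (suc d * R * (suc d * R))        ≡⟨ regroup d R ⟩
      2 * suc d * (R * R + d * (R * R))    ≤⟨ *-monoʳ-≤ (2 * suc d) (+-monoˡ-≤ (d * (R * R)) (≤-trans R*R≤d (m≤m+n d d))) ⟩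
      2 * suc d * (d + d + d * (R * R))    ≡⟨ collect d R ⟩
      d * suc (suc (d + d)) * (R * R + 2)  ∎
      where
      open ≤-Reasoning
      regroup : ∀ d R → 2 * (suc d * R * (suc d * R)) ≡ 2 * suc d * (R * R + d * (R * R))
      regroup = solve-∀
      collect : ∀ d R → 2 * suc d * (d + d + d * (R * R)) ≡ d * suc (suc (d + d)) * (R * R + 2)
      collect = solve-∀

    m*2^L<2^[L+L] : ∀ {m} → m ≤ t → m * 2 ^ L < 2 ^ (L + L)
    m*2^L<2^[L+L] {m} m≤t = begin-strict
      m * 2 ^ L               <⟨ *-monoˡ-< (2 ^ L) {{>-nonZero (m^n>0 2 L)}} (≤-<-trans m≤t t<2^R²) ⟩
      2 ^ (R * R) * 2 ^ L     ≡⟨ ^-distribˡ-+-* 2 (R * R) L ⟨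
      2 ^ (R * R + L)         ≤⟨ ^-monoʳ-≤ 2 (+-monoˡ-≤ L (m≤m+n (R * R) 2)) ⟩
      2 ^ (L + L)             ∎
      where open ≤-Reasoning

    Dd[qλ′+s]≤n : Dd * (q * λ′ + s) ≤ n
    Dd[qλ′+s]≤n = begin
      Dd * (q * λ′ + s)            ≤⟨ *-monoʳ-≤ Dd qλ′+s≤2t²X ⟩
      Dd * (2 * (t * t) * X)       ≡⟨ regroup Dd t X ⟩
      t * t * (2 * Dd * X)         ≤⟨ *-monoʳ-≤ (t * t) 2DdX≤t ⟩
      t * t * t                    ≡⟨ t^3≡t*t*t t ⟨
      t ^ 3                        ∎
      where
      open ≤-Reasoning
      regroup : ∀ D t X → D * (2 * (t * t) * X) ≡ t * t * (2 * D * X)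
      regroup = solve-∀
      double : ∀ q l t → 2 * (q * l + 2 * (t * t)) ≡ 2 * q * l + 4 * (t * t)
      double = solve-∀
      factor : ∀ t l → t * l + 4 * (t * t) ≡ t * (l + 4 * t)
      factor = solve-∀
      halve : ∀ t X → t * (4 * t * X) ≡ 2 * (2 * (t * t) * X)
      halve = solve-∀
      qλ′+s≤2t²X : q * λ′ + s ≤ 2 * (t * t) * X
      qλ′+s≤2t²X = *-cancelˡ-≤ 2 (begin
        2 * (q * λ′ + 2 * t ^ 2)     ≡⟨ cong (λ x → 2 * (q * λ′ + 2 * x)) (t^2≡t*t t) ⟩
        2 * (q * λ′ + 2 * (t * t))   ≡⟨ double q λ′ t ⟩
        2 * q * λ′ + 4 * (t * t)     ≤⟨ +-monoˡ-≤ (4 * (t * t)) (*-monoˡ-≤ λ′ 2q≤t) ⟩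
        t * λ′ + 4 * (t * t)         ≡⟨ factor t λ′ ⟩
        t * (λ′ + 4 * t)             ≤⟨ *-monoʳ-≤ t λ′+4t≤4tX ⟩
        t * (4 * t * X)              ≡⟨ halve t X ⟩
        2 * (2 * (t * t) * X)        ∎)

    free-room : ∀ {K A μ} → n ≤ K + s + A → K < q * suc μ → μ < λ′ → n ≤ q * λ′ + s + A
    free-room n≤K+s+A K<q[1+μ] μ<λ′ =
      ≤-trans n≤K+s+A (+-monoˡ-≤ _ (+-monoˡ-≤ s (≤-trans (<⇒≤ K<q[1+μ]) (*-monoʳ-≤ q μ<λ′))))

    weight-bound : ∀ {K A μ w} → n ≤ K + s + A → K < q * suc μ → suc μ ≤ w + λ′ →
      2 * n ≤ 2 * A + w * t + 2 * s * X
    weight-bound {K} {A} {μ} {w} n≤K+s+A K<q[1+μ] 1+μ≤w+λ′ = begin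
      2 * n                                       ≤⟨ *-monoʳ-≤ 2 n≤K+s+A ⟩
      2 * (K + s + A)                             ≡⟨ cong (λ x → 2 * (K + 2 * x + A)) (t^2≡t*t t) ⟩
      2 * (K + 2 * (t * t) + A)                   ≡⟨ spread K t A ⟩
      2 * K + (2 * A + 4 * (t * t))               ≤⟨ +-monoˡ-≤ _ (≤-trans (*-monoʳ-≤ 2 (<⇒≤ K<q[1+μ])) (≤-reflexive (sym (*-assoc 2 q (suc μ))))) ⟩
      2 * q * suc μ + (2 * A + 4 * (t * t))       ≤⟨ +-monoˡ-≤ _ (*-mono-≤ 2q≤t 1+μ≤w+λ′) ⟩
      t * (w + λ′) + (2 * A + 4 * (t * t))        ≡⟨ regroup t w λ′ A ⟩
      2 * A + w * t + t * (λ′ + 4 * t)            ≤⟨ +-monoʳ-≤ (2 * A + w * t) (*-monoʳ-≤ t λ′+4t≤4tX) ⟩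
      2 * A + w * t + t * (4 * t * X)             ≡⟨ cong (2 * A + w * t +_) (collect t X) ⟩
      2 * A + w * t + 2 * (2 * (t * t)) * X       ≡⟨ cong (λ x → 2 * A + w * t + 2 * (2 * x) * X) (t^2≡t*t t) ⟨
      2 * A + w * t + 2 * s * X                   ∎
      where
      open ≤-Reasoning
      spread : ∀ K t A → 2 * (K + 2 * (t * t) + A) ≡ 2 * K + (2 * A + 4 * (t * t))
      spread = solve-∀
      regroup : ∀ t w l A → t * (w + l) + (2 * A + 4 * (t * t)) ≡ 2 * A + w * t + t * (l + 4 * t)
      regroup = solve-∀
      collect : ∀ t X → t * (4 * t * X) ≡ 2 * (2 * (t * t)) * X
      collect = solve-∀


module FreeMatrix where

  open import Data.Bool using (Bool)
  open import Data.Nat as ℕ using (ℕ; zero; suc; _^_; _*_; _+_; _∸_; _≤_; _<_; _⊓_; z≤n; s≤s; z<s)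
  import Data.Nat.Properties as ℕ
  open import Data.Nat.DivMod using (_/_; m/n*n≤m)
  open import Data.Fin using (Fin; zero; suc)
  open import Data.Fin.Subset using (∣_∣)
  open import Data.Rational using (ℚ; 0ℚ; 1ℚ; ½) renaming (_<_ to _<ℚ_; _≤_ to _≤ℚ_; _-_ to _-ℚ_; _*_ to _*ℚ_)
  import Data.Rational.Properties as ℚ
  open import Data.Product using (∃-syntax; _×_; _,_; proj₁; proj₂)
  open import Data.Sum using (inj₁; inj₂)
  open import Relation.Binary.PropositionalEquality
  open import Data.Nat.Tactic.RingSolver using (solve-∀)
  open import Defs using (WeakTiling; GoodRow; rowWeight; isFree; outDeg; mem; countFin; sumFin; ℕ→ℚ)
  open WeakTiling using (m; W; W-disj; W-size; W-weak)
  open import Data.Vec.Properties using (lookup⇒[]=)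
  open FiniteSums
  open ConditionalExpectation
  open ChernoffBound using (estimator-bound)
  open RowGoodness
  open Counting
  open Parameters

  minimum : ∀ {m} → (Fin m → ℕ) → ℕ → ℕ
  minimum {zero}  f d = d
  minimum {suc m} f d = f zero ⊓ minimum (λ i → f (suc i)) d

  minimum-≤ : ∀ {m} (f : Fin m → ℕ) d i → minimum f d ≤ f i
  minimum-≤ f d zero    = ℕ.m⊓n≤m _ _
  minimum-≤ f d (suc i) = ℕ.≤-trans (ℕ.m⊓n≤n _ _) (minimum-≤ (λ j → f (suc j)) d i)

  minimum-≤-default : ∀ {m} (f : Fin m → ℕ) d → minimum f d ≤ d
  minimum-≤-default {zero}  f d = ℕ.≤-refl
  minimum-≤-default {suc m} f d = ℕ.≤-trans (ℕ.m⊓n≤n _ _) (minimum-≤-default (λ j → f (suc j)) d)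

  minimum-attained : ∀ {m} (f : Fin m → ℕ) d → (∀ i → f i ≤ d) → Fin m → ∃[ j ] (minimum f d ≡ f j)
  minimum-attained {suc zero}    f d f≤d _ = zero , ℕ.m≤n⇒m⊓n≡m (f≤d zero)
  minimum-attained {suc (suc m)} f d f≤d _ with ℕ.⊓-sel (f zero) (minimum (λ i → f (suc i)) d)
                                                  | minimum-attained (λ i → f (suc i)) d (λ i → f≤d (suc i)) zero
  ... | inj₁ eq | _        = zero , eq
  ... | inj₂ eq | j , eq′  = suc j , trans eq eq′

  module _ {η t D} (T : WeakTiling η t D) where

    |W|≡t² : ∀ i → countFin (mem (W T i)) ≡ t ^ 2
    |W|≡t² i = trans (sym (∣p∣≡countFin-mem (W T i))) (W-size T i)

    rows≤t : 0 < t → m T ≤ t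
    rows≤t t>0 = ℕ.*-cancelʳ-≤ (m T) t (t ^ 2) {{ℕ.>-nonZero (ℕ.m^n>0 t {{ℕ.>-nonZero t>0}} 2)}} (begin
      m T * t ^ 2                            ≡⟨ sumFin-const (m T) (t ^ 2) ⟨
      sumFin {m T} (λ _ → t ^ 2)             ≡⟨ sumFin-cong (λ i → sym (|W|≡t² i)) ⟩
      sumFin (λ i → countFin (mem (W T i)))  ≤⟨ sum-sizes≤n (W T) (λ i j v i∋v j∋v →
                                                 W-disj T i j v (lookup⇒[]= v (W T i) i∋v) (lookup⇒[]= v (W T j) j∋v)) ⟩
      t * t ^ 2                              ∎)
      where open ℕ.≤-Reasoning

    t^3≤free+t²+outDeg : ∀ i → t ^ 3 ≤ countFin (isFree D (W T i)) + t ^ 2 + outDeg D (W T i)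
    t^3≤free+t²+outDeg i = subst (λ x → t ^ 3 ≤ countFin (isFree D (W T i)) + x + outDeg D (W T i)) (|W|≡t² i)
                                  (free+size+outDeg≥n D (W T i))

  module Construction {η t D} (T : WeakTiling η t D) {Dd r} (cond : Conditions t Dd r) (t<2^R² : t < 2 ^ (suc r * suc r))
                      (0≤ρ : 0ℚ ≤ℚ ½ -ℚ η) (1≤ρDd : 1ℚ ≤ℚ (½ -ℚ η) *ℚ ℕ→ℚ Dd) where
    open Scales cond t<2^R²
    open Conditions cond using (exp-bound≤t³)

    instance
      q≢0 : ℕ.NonZero q
      q≢0 = ℕ.>-nonZero q>0

    free : Fin (m T) → Fin n → Bool
    free i = isFree D (W T i)

    free-at : Fin (m T) → ℕ → ℕ → Bool
    free-at i b j = liftℕ (free i) (b * q + j)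

    K μ A : Fin (m T) → ℕ
    K i = sum< s (λ b → hits q (free-at i b))
    μ i = K i / q
    A i = outDeg D (W T i)

    K≡sum< : ∀ i → K i ≡ sum< (s * q) (λ k → indicator (liftℕ (free i) k))
    K≡sum< i = sym (sum<-blocks s q (λ k → indicator (liftℕ (free i) k)))

    free≤K+t² : ∀ i → countFin (free i) ≤ K i + t ^ 2
    free≤K+t² i = begin
      countFin (free i)                                    ≡⟨ countFin-liftℕ (free i) ⟩
      sum< n F                                             ≡⟨ cong (λ x → sum< x F) (ℕ.m+[n∸m]≡n sq≤n) ⟨
      sum< (s * q + (n ∸ s * q)) F                         ≡⟨ sum<-splitAt (s * q) (n ∸ s * q) F ⟩
      sum< (s * q) F + sum< (n ∸ s * q) (λ k → F (s * q + k))  ≤⟨ ℕ.+-mono-≤ (ℕ.≤-reflexive (sym (K≡sum< i)))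
                                                                  (ℕ.≤-trans (sum<-indicator≤ _ _) (ℕ.m≤n+o⇒m∸n≤o n (s * q) n≤sq+t²)) ⟩
      K i + t ^ 2                                          ∎
      where
      open ℕ.≤-Reasoning
      F : ℕ → ℕ
      F k = indicator (liftℕ (free i) k)

    n≤K+s+A : ∀ i → n ≤ K i + s + A i
    n≤K+s+A i = begin
      t ^ 3                                             ≤⟨ t^3≤free+t²+outDeg T i ⟩
      countFin (free i) + t ^ 2 + A i                   ≤⟨ ℕ.+-monoˡ-≤ (A i) (ℕ.+-monoˡ-≤ (t ^ 2) (free≤K+t² i)) ⟩
      K i + t ^ 2 + t ^ 2 + A i                         ≡⟨ cong (_+ A i) (twice (K i) (t ^ 2)) ⟩
      K i + 2 * t ^ 2 + A i                             ∎
      where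
      open ℕ.≤-Reasoning
      twice : ∀ k x → k + x + x ≡ k + 2 * x
      twice = solve-∀

    K<q[1+μ] : ∀ i → K i < q * suc (μ i)
    K<q[1+μ] i = subst (K i <_) (ℕ.*-comm (suc (μ i)) q) (m<[1+m/n]*n (K i) q)

    μ≤s : ∀ i → μ i ≤ s
    μ≤s i = ℕ.*-cancelʳ-≤ (μ i) s q (ℕ.≤-trans (m/n*n≤m (K i) q)
                                       (subst (_≤ s * q) (sym (K≡sum< i)) (sum<-indicator≤ (s * q) (liftℕ (free i)))))

    λ′≤μ : ∀ i → λ′ ≤ μ i
    λ′≤μ i = ℕ.≮⇒≥ (λ μ<λ′ → ℕ.<⇒≱ (weak-slack η (A i) n (q * λ′ + s) Dd 0≤ρ (W-weak T i) 1≤ρDd Dd[qλ′+s]≤n)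
                                     (free-room (n≤K+s+A i) (K<q[1+μ] i) μ<λ′))

    -- Every row gets more than a hits; one threshold for all rows is what the union bound needs.
    μ-min a : ℕ
    μ-min = minimum μ s
    a = μ-min ∸ λ′

    a+λ′≡μ-min : Fin (m T) → a + λ′ ≡ μ-min
    a+λ′≡μ-min i = ℕ.m∸n+n≡m (subst (λ′ ≤_) (sym (proj₂ attained)) (λ′≤μ (proj₁ attained)))
      where attained = minimum-attained μ s μ≤s i

    q[a+λ′]≤K : ∀ i → q * (a + λ′) ≤ K i
    q[a+λ′]≤K i = begin
      q * (a + λ′)   ≡⟨ cong (q *_) (a+λ′≡μ-min i) ⟩
      q * μ-min      ≤⟨ ℕ.*-monoʳ-≤ q (minimum-≤ μ s i) ⟩
      q * μ i        ≡⟨ ℕ.*-comm q (μ i) ⟩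
      μ i * q        ≤⟨ m/n*n≤m (K i) q ⟩
      K i            ∎
      where open ℕ.≤-Reasoning

    a≤hL : a ≤ h * L
    a≤hL = ℕ.≤-trans (ℕ.m∸n≤m μ-min λ′) (ℕ.≤-trans (minimum-≤-default μ s) s≤hL)

    estimator-small : ∀ i → m T * (suc N ^ a * prod< s (λ b → sum< q (λ v → weight N (free-at i b v))))
                              < q ^ s * (suc N ^ s * N ^ a)
    estimator-small i =
      estimator-bound N q s a (m T) h L (L + L) (λ b → sum< q (λ v → weight N (free-at i b v))) (λ b → hits q (free-at i b))
                      q>0 h>0 N[2+N]≡2h a≤hL (m*2^L<2^[L+L] (rows≤t T (ℕ.≤-trans z<s t≥2)))
                      (λ b → sum<-weight+hits N q (free-at i b)) (q[a+λ′]≤K i)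

    s>0 : 0 < s
    s>0 = ℕ.*-mono-≤ {1} {2} (s≤s z≤n) (ℕ.m^n>0 t {{ℕ.>-nonZero (ℕ.≤-trans z<s t≥2)}} 2)

    st≡2n : s * t ≡ 2 * n
    st≡2n = trans (ℕ.*-assoc 2 (t ^ 2) t) (cong (2 *_) (ℕ.*-comm (t ^ 2) t))

    good-rows : ∀ {c} (c<q : ∀ b → b < s → c b < q) → (∀ i → a < hits s (λ b → free-at i b (c b))) →
      ∀ i → GoodRow η t ∣ selection n q s c ∣ (rowWeight T i (selection n q s c))
    good-rows {c} c<q a<hits i =
      subst (λ x → GoodRow η t x w) (sym (∣selection∣ sq≤n c<q))
        (good-row η t s w (A j) n X s>0 st≡2n (W-weak T j) (weight-bound (n≤K+s+A j) (K<q[1+μ] j) 1+μj≤w+λ′) exp-bound≤t³)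
      where
      w = rowWeight T i (selection n q s c)
      attained = minimum-attained μ s μ≤s i
      j = proj₁ attained
      a<w : a < w
      a<w = subst (a <_) (sym (countFin-selection-∧ sq≤n c<q (free i))) (a<hits i)
      1+μj≤w+λ′ : suc (μ j) ≤ w + λ′
      1+μj≤w+λ′ = subst (λ x → suc x ≤ w + λ′) (trans (a+λ′≡μ-min i) (proj₂ attained)) (ℕ.+-monoˡ-≤ λ′ a<w)

    good-selection : ∃[ U ] (∣ U ∣ ≡ 2 * t ^ 2 × (∀ i → GoodRow η t ∣ U ∣ (rowWeight T i U)))
    good-selection =
      let c , c<q , a<hits = many-hits q s a N free-at q>0 estimator-small
      in selection n q s c , ∣selection∣ sq≤n c<q , good-rows c<q a<hits

  module _ {η : ℚ} (η<½ : η <ℚ ½) where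
    private
      0<ρ : 0ℚ <ℚ ½ -ℚ η
      0<ρ = 0<q-p η<½
      multiple = ∃-multiple≥1 (½ -ℚ η) 0<ρ
      Dd = proj₁ multiple

    threshold : ℕ
    threshold = K₀ + 4 * Dd * Dd

    good-selection-beyond : ∀ t → threshold ≤ t → ∀ {D} (T : WeakTiling η t D) →
      ∃[ U ] (∣ U ∣ ≡ 2 * t ^ 2 × (∀ i → GoodRow η t ∣ U ∣ (rowWeight T i U)))
    good-selection-beyond t t₀≤t T =
      let r , 2^r²≤t , t<2^R² = ∃-log-root t t>0
      in Construction.good-selection T (conditions t Dd r t₀≤t 2^r²≤t) t<2^R² (ℚ.<⇒≤ 0<ρ) (proj₂ (proj₂ multiple))
      where
      t>0 : 0 < t
      t>0 = ℕ.≤-trans (ℕ.≤-trans z<s 25³≤K₀) (ℕ.≤-trans (ℕ.m≤m+n K₀ _) t₀≤t)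

open import Defs
open import Data.Nat using (ℕ; _^_; _*_; _≤_)
open import Data.Fin using (Fin)
open import Data.Fin.Subset using (Subset; ∣_∣)
open import Data.Bool using (Bool)
open import Data.Rational using (ℚ; _<_; 0ℚ; 1ℚ; ½)
open import Data.Product using (∃-syntax; _×_)
open import Relation.Binary.PropositionalEquality using (_≡_)
open import Data.Product using (_,_)
open FreeMatrix using (threshold; good-selection-beyond)

lemma18 : (κ η : ℚ) → 0ℚ < κ → κ < 1ℚ → 0ℚ < η → η < ½ →
    ∃[ t₀ ] (∀ (t : ℕ) → t₀ ≤ t →
      (G : Graph (t ^ 3)) → IsTemplate κ t G →
      (D : Fin (t ^ 3) → Fin (t ^ 3) → Bool) → IsOrientation G D →
      (T : WeakTiling η t D) →
      ∃[ U ] (∣ U ∣ ≡ 2 * t ^ 2 × (∀ i → GoodRow η t ∣ U ∣ (rowWeight T i U))))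
lemma18 κ η _ _ _ η<½ = threshold η<½ , λ t t₀≤t _ _ _ _ T → good-selection-beyond η<½ t t₀≤t T
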